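{- Let $M=p_1^{n_1}\cdots p_K^{n_K}$, $A,B\subset\mathbb{Z}_M$ with $A\oplus B=\mathbb{Z}_M$, and suppose $\Phi_{p_i^{n_i}}\mid A$. The following are equivalent: (I) for every $m$ with $p_i^{n_i}\mid m\mid M$, $m\in{\mathrm{Div}}(A)$ implies $m/p_i\notin{\mathrm{Div}}(B)$; (II) for every $r\in R$, the tiling $A\oplus rB=\mathbb{Z}_M$ has uniform $(rB,A)$ splitting parity in the $p_i$ direction; (III) for every $a\in A$ and $b\in B$, and every $x\in a*F_i$, we have $A_{x,b}\subset\Pi(x,p_i^{n_i})$.
   Context: $\Phi_s$ is the $s$-th cyclotomic polynomial, "$\Phi_s\mid A$" meaning $\Phi_s(X)\mid\sum_{a\in A}X^a$. $(x,m)$ for $x\in\mathbb{Z}_M$, $m\mid M$ is the gcd of $m$ with a representative of $x$; ${\mathrm{Div}}(A)=\{(a-a',M):a,a'\in A\}$. $R=\{r\in\mathbb{Z}_M:(r,M)=1\}$, $rB=\{rb:b\in B\}$ (which also tiles with $A$). $\Pi(x,p^\beta)=\{x':p^\beta\mid x-x'\}$. $F_i=\{tM/p_i:0\le t<p_i\}$, $x*F_i=x+F_i$. For a tiling $A\oplus C=\mathbb{Z}_M$ and $Z\subset\mathbb{Z}_M$: $\Sigma_A(Z)=\{a\in A:a+c\in Z\text{ for some }c\in C\}$, $\Sigma_C(Z)$ similarly. An $M$-fiber $Z=z*F_i$ splits with parity $(C,A)$ if $p_i^{n_i}\mid c-c'$ for all $c,c'\in\Sigma_C(Z)$ and $p_i^{n_i-1}\parallel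 a-a'$ for all distinct $a,a'\in\Sigma_A(Z)$. The tiling $A\oplus C$ has uniform $(C,A)$ splitting parity in the $p_i$ direction if every $z*F_i$, $z\in\mathbb{Z}_M$, splits with parity $(C,A)$. For $x,y\in\mathbb{Z}_M$ the saturating set is $A_{x,y}=\{a\in A:(x-a,M)=(y-b',M)\text{ for some }b'\in B\}$. -}

module Defs where

open import Data.Nat as ℕ using (ℕ; zero; suc; _≤_; _<_; _^_; _∸_; NonZero; nonTrivial⇒nonZero)
open import Data.Nat.DivMod using (_/_)
open import Data.Nat.Divisibility using (_∣_)
open import Data.Nat.GCD using (gcd)
open import Data.Nat.Primality using (Prime; prime)
open import Data.Integer as ℤ using (ℤ; +_; ∣_∣)
open import Data.Fin using (Fin; toℕ) renaming (zero to fzero; suc to fsuc)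
open import Data.Fin.Subset using (Subset; _∈_)
open import Data.Fin.Subset.Properties using (_∈?_)
open import Data.List as List using (List; []; _∷_; replicate; _++_; [_]; allFin; upTo)
open import Data.Product using (Σ; ∃; _×_; _,_)
open import Relation.Nullary using (¬_; yes; no)
open import Relation.Binary.PropositionalEquality using (_≡_; _≢_)

_/ₚ_ : ℕ → {p : ℕ} → Prime p → ℕ
_/ₚ_ m {p} (prime _) = _/_ m p {{ nonTrivial⇒nonZero p }}

∏ : (K : ℕ) → (Fin K → ℕ) → ℕ
∏ zero    f = 1
∏ (suc K) f = f fzero ℕ.* ∏ K (λ k → f (fsuc k))

modulus : (K : ℕ) → (Fin K → ℕ) → (Fin K → ℕ) → ℕ
modulus K p n = ∏ K (λ k → p k ^ n k)

-- ℤ_M : elements are Fin M (canonical representatives 0..M-1).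
-- Arithmetic in ℤ_M is done on integer representatives; all notions
-- below only depend on residues mod M.

ι : {M : ℕ} → Fin M → ℤ
ι x = + toℕ x

_∣ℤ_ : ℕ → ℤ → Set
m ∣ℤ z = m ∣ ∣ z ∣

gcdM : ℕ → ℤ → ℕ
gcdM M z = gcd M ∣ z ∣

SetM : ℕ → Set₁
SetM M = Fin M → Set

Div : {M : ℕ} → SetM M → ℕ → Set
Div {M} A m = ∃ λ a → ∃ λ a' → A a × A a' × gcdM M (ι a ℤ.- ι a') ≡ m

Tiling : {M : ℕ} → SetM M → SetM M → Set
Tiling {M} A C =
  ((x : Fin M) → ∃ λ a → ∃ λ c → A a × C c × M ∣ℤ ((ι a ℤ.+ ι c) ℤ.- ι x))
  × (∀ a a' c c' → A a → A a' → C c → C c' →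
       M ∣ℤ ((ι a ℤ.+ ι c) ℤ.- (ι a' ℤ.+ ι c')) → a ≡ a' × c ≡ c')

InR : {M : ℕ} → Fin M → Set
InR {M} r = gcd (toℕ r) M ≡ 1

scale : {M : ℕ} → Fin M → SetM M → SetM M
scale {M} r B x = ∃ λ b → B b × M ∣ℤ ((ι r ℤ.* ι b) ℤ.- ι x)

Π : {M : ℕ} → Fin M → ℕ → SetM M
Π x q x' = q ∣ℤ (ι x ℤ.- ι x')

Fiber : {M : ℕ} {pᵢ : ℕ} → Prime pᵢ → Fin M → SetM M
Fiber {M} {pᵢ} pr z w =
  ∃ λ t → t < pᵢ × M ∣ℤ (ι w ℤ.- (ι z ℤ.+ + (t ℕ.* (M /ₚ pr))))

ΣA : {M : ℕ} → SetM M → SetM M → SetM M → SetM M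
ΣA {M} A C Z a = A a × ∃ λ c → C c × ∃ λ w → Z w × M ∣ℤ ((ι a ℤ.+ ι c) ℤ.- ι w)

ΣC : {M : ℕ} → SetM M → SetM M → SetM M → SetM M
ΣC A C Z = ΣA C A Z

SplitsCA : {M : ℕ} {pᵢ : ℕ} → Prime pᵢ → ℕ → SetM M → SetM M → Fin M → Set
SplitsCA {M} {pᵢ} pr nᵢ A C z =
  (∀ c c' → ΣC A C Z c → ΣC A C Z c' → (pᵢ ^ nᵢ) ∣ℤ (ι c ℤ.- ι c'))
  × (∀ a a' → ΣA A C Z a → ΣA A C Z a' → a ≢ a' →
       ((pᵢ ^ (nᵢ ∸ 1)) ∣ℤ (ι a ℤ.- ι a')) × ¬ ((pᵢ ^ nᵢ) ∣ℤ (ι a ℤ.- ι a')))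
  where Z = Fiber pr z

UniformSplitCA : {M : ℕ} {pᵢ : ℕ} → Prime pᵢ → ℕ → SetM M → SetM M → Set
UniformSplitCA {M} pr nᵢ A C = (z : Fin M) → SplitsCA pr nᵢ A C z

Sat : {M : ℕ} → SetM M → SetM M → Fin M → Fin M → SetM M
Sat {M} A B x y a = A a × ∃ λ b' → B b' × gcdM M (ι x ℤ.- ι a) ≡ gcdM M (ι y ℤ.- ι b')

-- Integer polynomials as coefficient lists (index k = coefficient of X^k)

Poly : Set
Poly = List ℤ

coeff : Poly → ℕ → ℤ
coeff []      k       = + 0
coeff (c ∷ _) zero    = c
coeff (_ ∷ f) (suc k) = coeff f k

_+ₚ_ : Poly → Poly → Poly
[]      +ₚ g       = g
f       +ₚ []      = f
(c ∷ f) +ₚ (d ∷ g) = (c ℤ.+ d) ∷ (f +ₚ g)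

_*ₚ_ : Poly → Poly → Poly
[]      *ₚ g = []
(c ∷ f) *ₚ g = List.map (c ℤ.*_) g +ₚ (+ 0 ∷ (f *ₚ g))

sumₚ : List Poly → Poly
sumₚ = List.foldr _+ₚ_ []

X^ : ℕ → Poly
X^ k = replicate k (+ 0) ++ [ + 1 ]

-- equality of polynomials (coefficientwise, ignoring trailing zeros)
_≈ₚ_ : Poly → Poly → Set
f ≈ₚ g = ∀ k → coeff f k ≡ coeff g k

_∣ₚ_ : Poly → Poly → Set
f ∣ₚ g = ∃ λ q → (f *ₚ q) ≈ₚ g

-- cyclotomic polynomial of a prime power: Φ_{p^n}(X) = Σ_{j<p} X^{j p^{n-1}}  (n ≥ 1)
Φpp : ℕ → ℕ → Poly
Φpp p n = sumₚ (List.map (λ j → X^ (j ℕ.* p ^ (n ∸ 1))) (upTo p))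

mask : {M : ℕ} → Subset M → Poly
mask {M} A = sumₚ (List.map term (allFin M))
  where
  term : Fin M → Poly
  term a with a ∈? A
  ... | yes _ = X^ (toℕ a)
  ... | no  _ = []

⟦_⟧ : {M : ℕ} → Subset M → SetM M
⟦ A ⟧ x = x ∈ A

module Submission where

-- Two facts drive the proof.
-- (1) Sands: Div(A) ∩ Div(B) = {M}. If (a − a', M) = (b − b', M), then a − a' ≡ r (b − b') for a unit r,
--     and A ⊕ rB is again a tiling (Tijdeman; for a prime ℓ ∤ M, count mod ℓ using the Frobenius congruence
--     L^ℓ ≡ ℓL in ℕ[ℤ_M]), so a + r b' ≡ a' + r b forces a = a'.
-- (2) If u ≡ w mod M/p_i, then (u, M) = (w, M) unless exactly one of u, w is divisible by p_i^{n_i},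
--     in which case its gcd with M is p_i times the other's.
-- Each implication applies (2) to a − a' and a difference shifted along a p_i-fiber: the equal-gcd case
-- collapses by (1), and the other case is exactly a pair m ∈ Div(A), m/p_i ∈ Div(B) excluded by (I).

open import Data.Nat using (ℕ; NonZero; suc)
import Data.Nat as ℕ
open import Data.Nat.Divisibility using (_∣_)
open import Data.Nat.Primality using (Prime)
open import Data.Integer using (ℤ)
open import Data.List using (List)
open import Data.Fin.Subset using (Subset)
open import Relation.Binary.PropositionalEquality using (_≡_)
open import Relation.Nullary using (¬_)
open import Defs using (Tiling; ⟦_⟧)

module ListSum where

  open import Data.Nat using (ℕ; zero; suc; _+_; _≤_; z≤n; s≤s)
  open import Data.Nat.Properties
  open import Algebra.Properties.CommutativeSemigroup +-commutativeSemigroup using (interchange)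
  open import Data.List using (List; []; _∷_; _++_; map; length)
  open import Data.List.Membership.Propositional using (_∈_)
  open import Data.List.Relation.Unary.Any using (here; there)
  import Data.List.Relation.Unary.All as All
  open import Data.List.Relation.Unary.AllPairs using (_∷_)
  open import Data.List.Relation.Unary.Unique.Propositional using (Unique)
  open import Data.Product using (∃; _,_; _×_)
  open import Relation.Binary.PropositionalEquality
  open import Relation.Nullary using (contradiction)

  ∑ : {A : Set} → (A → ℕ) → List A → ℕ
  ∑ f []       = 0
  ∑ f (x ∷ xs) = f x + ∑ f xs

  module _ {A : Set} where

    ∑-++ : ∀ (f : A → ℕ) xs ys → ∑ f (xs ++ ys) ≡ ∑ f xs + ∑ f ys
    ∑-++ f []       ys = refl
    ∑-++ f (x ∷ xs) ys = trans (cong (f x +_) (∑-++ f xs ys)) (sym (+-assoc (f x) _ _))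

    ∑-cong : ∀ {f g : A → ℕ} xs → (∀ x → f x ≡ g x) → ∑ f xs ≡ ∑ g xs
    ∑-cong []       f≗g = refl
    ∑-cong (x ∷ xs) f≗g = cong₂ _+_ (f≗g x) (∑-cong xs f≗g)

    ∑-distrib-+ : ∀ (f g : A → ℕ) xs → ∑ (λ x → f x + g x) xs ≡ ∑ f xs + ∑ g xs
    ∑-distrib-+ f g []       = refl
    ∑-distrib-+ f g (x ∷ xs) =
      trans (cong (f x + g x +_) (∑-distrib-+ f g xs)) (interchange (f x) (g x) (∑ f xs) (∑ g xs))

    ∑-zero : ∀ {f : A → ℕ} xs → (∀ x → x ∈ xs → f x ≡ 0) → ∑ f xs ≡ 0
    ∑-zero []       f≡0 = refl
    ∑-zero (x ∷ xs) f≡0 = cong₂ _+_ (f≡0 x (here refl)) (∑-zero xs (λ y y∈ → f≡0 y (there y∈)))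

    ∑-const-1 : ∀ xs → ∑ (λ (x : A) → 1) xs ≡ length xs
    ∑-const-1 []       = refl
    ∑-const-1 (x ∷ xs) = cong suc (∑-const-1 xs)

    ∈⇒≤∑ : ∀ (f : A → ℕ) {x} xs → x ∈ xs → f x ≤ ∑ f xs
    ∈⇒≤∑ f (y ∷ xs) (here refl) = m≤m+n (f y) _
    ∈⇒≤∑ f (y ∷ xs) (there x∈)  = ≤-trans (∈⇒≤∑ f xs x∈) (m≤n+m _ (f y))

    ∈-distinct⇒≤∑ : ∀ (f : A → ℕ) {x y} xs → x ∈ xs → y ∈ xs → x ≢ y → f x + f y ≤ ∑ f xs
    ∈-distinct⇒≤∑ f (z ∷ xs) (here refl) (here refl) x≢y = contradiction refl x≢y
    ∈-distinct⇒≤∑ f (z ∷ xs) (here refl) (there y∈)  _   = +-monoʳ-≤ (f z) (∈⇒≤∑ f xs y∈)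
    ∈-distinct⇒≤∑ f {x} (z ∷ xs) (there x∈) (here refl) _ =
      subst (_≤ f z + ∑ f xs) (+-comm (f z) (f x)) (+-monoʳ-≤ (f z) (∈⇒≤∑ f xs x∈))
    ∈-distinct⇒≤∑ f (z ∷ xs) (there x∈) (there y∈) x≢y =
      ≤-trans (∈-distinct⇒≤∑ f xs x∈ y∈ x≢y) (m≤n+m _ (f z))

    ∑-positive : ∀ (f : A → ℕ) xs → 1 ≤ ∑ f xs → ∃ λ x → x ∈ xs × 1 ≤ f x
    ∑-positive f (x ∷ xs) 1≤∑ with f x in fx≡
    ... | zero  = let (y , y∈ , 1≤fy) = ∑-positive f xs 1≤∑ in y , there y∈ , 1≤fy
    ... | suc _ = x , here refl , subst (1 ≤_) (sym fx≡) (s≤s z≤n)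

    ∑-≤1 : ∀ (f : A → ℕ) xs → Unique xs → (∀ x → x ∈ xs → f x ≤ 1) →
           (∀ x y → x ∈ xs → y ∈ xs → 1 ≤ f x → 1 ≤ f y → x ≡ y) → ∑ f xs ≤ 1
    ∑-≤1 f []       _           _   _      = z≤n
    ∑-≤1 f (x ∷ xs) (x∉xs ∷ uxs) f≤1 unique with f x in fx≡
    ... | zero  = ∑-≤1 f xs uxs (λ y y∈ → f≤1 y (there y∈))
                    (λ y z y∈ z∈ → unique y z (there y∈) (there z∈))
    ... | suc k = begin
      suc k + ∑ f xs ≡⟨ cong (suc k +_) (∑-zero xs rest≡0) ⟩
      suc k + 0      ≡⟨ +-identityʳ (suc k) ⟩
      suc k          ≡⟨ fx≡ ⟨
      f x            ≤⟨ f≤1 x (here refl) ⟩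
      1              ∎
      where
      open ≤-Reasoning
      ≢x : ∀ {y} → y ∈ xs → x ≢ y
      ≢x = All.lookup x∉xs
      rest≡0 : ∀ y → y ∈ xs → f y ≡ 0
      rest≡0 y y∈ with f y in fy≡
      ... | zero  = refl
      ... | suc _ = contradiction
        (unique x y (here refl) (there y∈) (subst (1 ≤_) (sym fx≡) (s≤s z≤n)) (subst (1 ≤_) (sym fy≡) (s≤s z≤n)))
        (≢x y∈)

    ∑-≡length⇒≡1 : ∀ (f : A → ℕ) xs → (∀ x → x ∈ xs → 1 ≤ f x) → ∑ f xs ≡ length xs →
                   ∀ x → x ∈ xs → f x ≡ 1
    ∑-≡length⇒≡1 f (y ∷ xs) 1≤f ∑≡len x x∈ = go x∈
      where
      length≤∑ : ∀ zs → (∀ z → z ∈ zs → 1 ≤ f z) → length zs ≤ ∑ f zs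
      length≤∑ []       _   = z≤n
      length≤∑ (z ∷ zs) 1≤f = +-mono-≤ (1≤f z (here refl)) (length≤∑ zs (λ w w∈ → 1≤f w (there w∈)))
      1≤f-xs : ∀ z → z ∈ xs → 1 ≤ f z
      1≤f-xs z z∈ = 1≤f z (there z∈)
      fy≡1 : f y ≡ 1
      fy≡1 = ≤-antisym
        (+-cancelʳ-≤ (∑ f xs) (f y) 1 (≤-trans (≤-reflexive ∑≡len) (s≤s (length≤∑ xs 1≤f-xs))))
        (1≤f y (here refl))
      ∑-xs : ∑ f xs ≡ length xs
      ∑-xs = +-cancelˡ-≡ 1 (∑ f xs) (length xs) (trans (cong (_+ ∑ f xs) (sym fy≡1)) ∑≡len)
      go : x ∈ y ∷ xs → f x ≡ 1
      go (here refl) = fy≡1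
      go (there x∈)  = ∑-≡length⇒≡1 f xs 1≤f-xs ∑-xs x x∈

  module _ {A B : Set} where

    ∑-map : ∀ (f : B → ℕ) (g : A → B) xs → ∑ f (map g xs) ≡ ∑ (λ x → f (g x)) xs
    ∑-map f g []       = refl
    ∑-map f g (x ∷ xs) = cong (f (g x) +_) (∑-map f g xs)

    ∑-comm : ∀ (h : A → B → ℕ) xs ys → ∑ (λ x → ∑ (h x) ys) xs ≡ ∑ (λ y → ∑ (λ x → h x y) xs) ys
    ∑-comm h []       ys = sym (∑-zero ys (λ _ _ → refl))
    ∑-comm h (x ∷ xs) ys = trans (cong (∑ (h x) ys +_) (∑-comm h xs ys))
                                 (sym (∑-distrib-+ (h x) (λ y → ∑ (λ x → h x y) xs) ys))

module Congruence where

  open import Defs using (_∣ℤ_; ι)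
  open import Data.Nat as ℕ using (ℕ; zero; suc)
  import Data.Nat.Properties as ℕ
  import Data.Nat.Divisibility as ℕ
  open import Data.Integer using (ℤ; +_; _+_; _-_; _*_; -_; ∣_∣; _⊖_)
  import Data.Integer.Properties as ℤ
  open import Data.Integer.DivMod using (_%ℕ_; _/ℕ_; n%ℕd<d; a≡a%ℕn+[a/ℕn]*n)
  open import Data.Fin using (Fin; fromℕ<)
  open import Data.Fin.Properties using (toℕ-fromℕ<)
  open import Relation.Nullary using (contradiction)
  import Data.Integer.Divisibility.Signed as Signed
  open import Data.Integer.Tactic.RingSolver using (solve-∀)
  open import Relation.Binary.Bundles using (Setoid)
  open import Relation.Binary.PropositionalEquality using (_≡_; refl; sym; cong; subst; subst₂; module ≡-Reasoning)
  import Relation.Binary.Reasoning.Setoid as SetoidReasoning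

  module _ {d : ℕ} where

    ∣ℤ⇒∣ : ∀ z → d ∣ℤ z → + d Signed.∣ z
    ∣ℤ⇒∣ z = Signed.∣ᵤ⇒∣ {+ d} {z}

    ∣⇒∣ℤ : ∀ z → + d Signed.∣ z → d ∣ℤ z
    ∣⇒∣ℤ z = Signed.∣⇒∣ᵤ {+ d} {z}

    ∣ℤ-+ : ∀ x y → d ∣ℤ x → d ∣ℤ y → d ∣ℤ (x + y)
    ∣ℤ-+ x y d∣x d∣y = ∣⇒∣ℤ (x + y) (Signed.∣m∣n⇒∣m+n (∣ℤ⇒∣ x d∣x) (∣ℤ⇒∣ y d∣y))

    ∣ℤ-- : ∀ x y → d ∣ℤ x → d ∣ℤ y → d ∣ℤ (x - y)
    ∣ℤ-- x y d∣x d∣y = ∣⇒∣ℤ (x - y) (Signed.∣m∣n⇒∣m-n (∣ℤ⇒∣ x d∣x) (∣ℤ⇒∣ y d∣y))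

    ∣ℤ-neg : ∀ x → d ∣ℤ x → d ∣ℤ (- x)
    ∣ℤ-neg x = subst (d ℕ.∣_) (sym (ℤ.∣-i∣≡∣i∣ x))

    ∣ℤ-*ˡ : ∀ k x → d ∣ℤ x → d ∣ℤ (k * x)
    ∣ℤ-*ˡ k x d∣x = ∣⇒∣ℤ (k * x) (Signed.∣n⇒∣m*n k (∣ℤ⇒∣ x d∣x))

  -- A record, so that both sides of a congruence can be inferred.
  record _≡_[mod_] (x y : ℤ) (m : ℕ) : Set where
    constructor mod
    field ∣diff : m ∣ℤ (x - y)

  infix 4 _≡_[mod_]
  open _≡_[mod_] public

  module _ {m : ℕ} where

    mod-refl : ∀ {x} → x ≡ x [mod m ]
    mod-refl {x} = mod (subst (λ z → m ∣ℤ z) (sym (ℤ.+-inverseʳ x)) (m ℕ.∣0))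

    mod-reflexive : ∀ {x y} → x ≡ y → x ≡ y [mod m ]
    mod-reflexive refl = mod-refl

    mod-sym : ∀ {x y} → x ≡ y [mod m ] → y ≡ x [mod m ]
    mod-sym {x} {y} (mod m∣x-y) = mod (subst (m ∣ℤ_) (neg-sub x y) (∣ℤ-neg (x - y) m∣x-y))
      where
      neg-sub : ∀ x y → - (x - y) ≡ y - x
      neg-sub = solve-∀

    mod-trans : ∀ {x y z} → x ≡ y [mod m ] → y ≡ z [mod m ] → x ≡ z [mod m ]
    mod-trans {x} {y} {z} (mod p) (mod q) = mod (subst (m ∣ℤ_) (telescope x y z) (∣ℤ-+ (x - y) (y - z) p q))
      where
      telescope : ∀ x y z → (x - y) + (y - z) ≡ x - z
      telescope = solve-∀

    +-cong-mod : ∀ {x y u v} → x ≡ y [mod m ] → u ≡ v [mod m ] → x + u ≡ y + v [mod m ]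
    +-cong-mod {x} {y} {u} {v} (mod p) (mod q) =
      mod (subst (m ∣ℤ_) (regroup x y u v) (∣ℤ-+ (x - y) (u - v) p q))
      where
      regroup : ∀ x y u v → (x - y) + (u - v) ≡ (x + u) - (y + v)
      regroup = solve-∀

    *-congˡ-mod : ∀ k {x y} → x ≡ y [mod m ] → k * x ≡ k * y [mod m ]
    *-congˡ-mod k {x} {y} (mod p) = mod (subst (m ∣ℤ_) (distrib k x y) (∣ℤ-*ˡ k (x - y) p))
      where
      distrib : ∀ k x y → k * (x - y) ≡ k * x - k * y
      distrib = solve-∀

    mod-∣ : ∀ {d x y} → d ℕ.∣ m → x ≡ y [mod m ] → x ≡ y [mod d ]
    mod-∣ d∣m (mod p) = mod (ℕ.∣-trans d∣m p)

    ∣ℤ-resp-mod : ∀ {d x y} → d ℕ.∣ m → x ≡ y [mod m ] → d ∣ℤ x → d ∣ℤ y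
    ∣ℤ-resp-mod {d} {x} {y} d∣m x≡y d∣x =
      subst (d ∣ℤ_) (cancel x y) (∣ℤ-- x (x - y) d∣x (∣diff (mod-∣ d∣m x≡y)))
      where
      cancel : ∀ x y → x - (x - y) ≡ y
      cancel = solve-∀

  modSetoid : ℕ → Setoid _ _
  modSetoid m = record
    { Carrier       = ℤ
    ; _≈_           = _≡_[mod m ]
    ; isEquivalence = record { refl = mod-refl ; sym = mod-sym ; trans = mod-trans }
    }

  module ≡-mod-Reasoning (m : ℕ) = SetoidReasoning (modSetoid m)

  module _ (M : ℕ) .{{_ : ℕ.NonZero M}} where

    ≡%ℕ : ∀ x → x ≡ + (x %ℕ M) [mod M ]
    ≡%ℕ x = mod (∣⇒∣ℤ (x - + r) (Signed.divides (x /ℕ M) (begin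
      x - + r                           ≡⟨ cong (_- + r) (a≡a%ℕn+[a/ℕn]*n x M) ⟩
      (+ r + (x /ℕ M) * + M) - + r      ≡⟨ cancel (+ r) ((x /ℕ M) * + M) ⟩
      (x /ℕ M) * + M                    ∎)))
      where
      open ≡-Reasoning
      r = x %ℕ M
      cancel : ∀ a b → (a + b) - a ≡ b
      cancel = solve-∀

    residue : ℤ → Fin M
    residue x = fromℕ< (n%ℕd<d x M)

    ≡residue : ∀ x → x ≡ ι (residue x) [mod M ]
    ≡residue x = subst (λ r → x ≡ + r [mod M ]) (sym (toℕ-fromℕ< (n%ℕd<d x M))) (≡%ℕ x)

    residue-unique : ∀ {c k} → c ℕ.< M → k ℕ.< M → + c ≡ + k [mod M ] → c ≡ k
    residue-unique {c} {k} c<M k<M (mod M∣c-k) with ∣ + c - + k ∣ in eq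
    ... | zero  = ℤ.+-injective (ℤ.i-j≡0⇒i≡j (+ c) (+ k) (ℤ.∣i∣≡0⇒i≡0 eq))
    ... | suc t = contradiction M∣c-k (ℕ.>⇒∤ (begin-strict
      suc t          ≡⟨ eq ⟨
      ∣ + c - + k ∣  ≡⟨ cong ∣_∣ (ℤ.[+m]-[+n]≡m⊖n c k) ⟩
      ∣ c ⊖ k ∣      ≤⟨ ℤ.∣m⊝n∣≤m⊔n c k ⟩
      c ℕ.⊔ k        <⟨ ℕ.⊔-lub c<M k<M ⟩
      M              ∎))
      where open ℕ.≤-Reasoning

  module _ {m : ℕ} where

    ∣⇒≡0 : ∀ {a} → m ℕ.∣ a → + a ≡ + 0 [mod m ]
    ∣⇒≡0 {a} m∣a = mod (subst (m ℕ.∣_) (sym (ℕ.+-identityʳ a)) m∣a)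

    ≡0⇒∣ : ∀ {a} → + a ≡ + 0 [mod m ] → m ℕ.∣ a
    ≡0⇒∣ {a} (mod m∣a+0) = subst (m ℕ.∣_) (ℕ.+-identityʳ a) m∣a+0

    *-congʳ-mod : ∀ k {x y} → x ≡ y [mod m ] → x * k ≡ y * k [mod m ]
    *-congʳ-mod k {x} {y} x≡y = subst₂ _≡_[mod m ] (ℤ.*-comm k x) (ℤ.*-comm k y) (*-congˡ-mod k x≡y)

    *-scale-mod : ∀ d {x y} → x ≡ y [mod m ] → x * + d ≡ y * + d [mod m ℕ.* d ]
    *-scale-mod d {x} {y} (mod m∣x-y) = mod (subst (m ℕ.* d ℕ.∣_) (begin
      ∣ x - y ∣ ℕ.* d        ≡⟨ ℤ.abs-* (x - y) (+ d) ⟨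
      ∣ (x - y) * + d ∣      ≡⟨ cong ∣_∣ (distrib x y (+ d)) ⟩
      ∣ x * + d - y * + d ∣  ∎) (ℕ.*-monoˡ-∣ d m∣x-y))
      where
      open ≡-Reasoning
      distrib : ∀ x y d → (x - y) * d ≡ x * d - y * d
      distrib = solve-∀

module Primes where

  open import Data.Nat using (ℕ; zero; suc; _*_; _^_; _∸_; _<_; _!; NonZero; ≢-nonZero; ≢-nonZero⁻¹)
  open import Data.Nat.GCD using (gcd; gcd[m,n]∣m; gcd[m,n]∣n; gcd[m,n]≡0⇒n≡0)
  open import Data.Nat.Properties
  open import Data.Nat.Divisibility
  open import Data.Nat.Primality using (Prime; euclidsLemma; prime⇒nonZero; prime⇒irreducible; ¬prime[1])
  open import Data.Nat.Combinatorics using (_C_; nCk≡n!/k![n-k]!; k![n∸k]!∣n!)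
  open import Data.Nat.DivMod using (m/n*n≡m)
  open import Data.Nat.ListAction using (product)
  open import Data.Nat.Primality.Factorisation using (PrimeFactorisation; factorise)
  open import Data.List using ([]; _∷_)
  open import Data.List.Membership.Propositional using (_∈_)
  open import Data.List.Relation.Unary.Any using (here; there)
  open import Data.List.Relation.Unary.All using (All; _∷_)
  open import Data.Product using (∃; _×_; _,_)
  open import Data.Sum using (inj₁; inj₂)
  open import Relation.Binary.PropositionalEquality using (_≡_; _≢_; refl; sym; trans; cong; subst)
  open import Relation.Nullary using (¬_; contradiction; yes; no)

  module _ {p : ℕ} (p-prime : Prime p) where

    prime∤1 : ¬ p ∣ 1
    prime∤1 p∣1 = ¬prime[1] (subst Prime (∣1⇒≡1 p∣1) p-prime)

    prime∣^⇒∣ : ∀ {b} e → p ∣ b ^ e → p ∣ b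
    prime∣^⇒∣ zero        p∣1   = contradiction p∣1 prime∤1
    prime∣^⇒∣ {b} (suc e) p∣b^e with euclidsLemma b (b ^ e) p-prime p∣b^e
    ... | inj₁ p∣b  = p∣b
    ... | inj₂ p∣b^ = prime∣^⇒∣ e p∣b^

    prime∣prime⇒≡ : ∀ {q} → Prime q → p ∣ q → p ≡ q
    prime∣prime⇒≡ q-prime p∣q with prime⇒irreducible q-prime p∣q
    ... | inj₁ refl = contradiction p-prime ¬prime[1]
    ... | inj₂ p≡q  = p≡q

    prime∣product⇒∣∈ : ∀ xs → p ∣ product xs → ∃ λ x → x ∈ xs × p ∣ x
    prime∣product⇒∣∈ []       p∣1  = contradiction p∣1 prime∤1
    prime∣product⇒∣∈ (x ∷ xs) p∣xs with euclidsLemma x (product xs) p-prime p∣xs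
    ... | inj₁ p∣x  = x , here refl , p∣x
    ... | inj₂ p∣xs' with prime∣product⇒∣∈ xs p∣xs'
    ...   | y , y∈xs , p∣y = y , there y∈xs , p∣y

    prime∤! : ∀ m → m < p → ¬ p ∣ m !
    prime∤! zero    _   p∣1  = prime∤1 p∣1
    prime∤! (suc m) m<p p∣m! with euclidsLemma (suc m) (m !) p-prime p∣m!
    ... | inj₁ p∣1+m = <⇒≱ m<p (∣⇒≤ p∣1+m)
    ... | inj₂ p∣m!' = prime∤! m (≤-trans (n≤1+n (suc m)) m<p) p∣m!'

    prime∣binomial : ∀ k → 0 < k → k < p → p ∣ p C k
    prime∣binomial k 0<k k<p with euclidsLemma (p C k) (k ! * (p ∸ k) !) p-prime p∣C*k!*[p∸k]!
      where
      instance
        _ = prime⇒nonZero p-prime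
        _ = k !* (p ∸ k) !≢0
      n∣n! : ∀ n → .{{NonZero n}} → n ∣ n !
      n∣n! (suc n) = m∣m*n (n !)
      p∣C*k!*[p∸k]! : p ∣ (p C k) * (k ! * (p ∸ k) !)
      p∣C*k!*[p∸k]! = subst (p ∣_)
        (sym (trans (cong (_* (k ! * (p ∸ k) !)) (nCk≡n!/k![n-k]! (<⇒≤ k<p))) (m/n*n≡m (k![n∸k]!∣n! (<⇒≤ k<p)))))
        (n∣n! p)
    ... | inj₁ p∣C = p∣C
    ... | inj₂ p∣k!*[p∸k]! with euclidsLemma (k !) ((p ∸ k) !) p-prime p∣k!*[p∸k]!
    ...   | inj₁ p∣k!     = contradiction p∣k! (prime∤! k k<p)
    ...   | inj₂ p∣[p∸k]! = contradiction p∣[p∸k]! (prime∤! (p ∸ k) (∸-monoʳ-< {p} {k} {0} 0<k (<⇒≤ k<p)))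

  prime-divisor : ∀ n .{{_ : NonZero n}} → n ≢ 1 → ∃ λ p → Prime p × p ∣ n
  prime-divisor n n≢1 = first factors isFactorisation factorsPrime
    where
    open PrimeFactorisation (factorise n)
    first : ∀ ps → n ≡ product ps → All Prime ps → ∃ λ p → Prime p × p ∣ n
    first []       n≡1 _              = contradiction n≡1 n≢1
    first (p ∷ ps) n≡∏ (p-prime ∷ _) = p , p-prime , subst (p ∣_) (sym n≡∏) (m∣m*n (product ps))

  coprime-by-primes : ∀ m n .{{_ : NonZero n}} → (∀ {p} → Prime p → p ∣ m → ¬ p ∣ n) → gcd m n ≡ 1
  coprime-by-primes m n no-common with gcd m n ≟ 1
  ... | yes gcd≡1 = gcd≡1
  ... | no  gcd≢1 with prime-divisor (gcd m n) {{gcd≢0}} gcd≢1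
    where gcd≢0 = ≢-nonZero (λ gcd≡0 → ≢-nonZero⁻¹ n (gcd[m,n]≡0⇒n≡0 m gcd≡0))
  ...   | p , p-prime , p∣gcd = contradiction (∣-trans p∣gcd (gcd[m,n]∣n m n)) (no-common p-prime (∣-trans p∣gcd (gcd[m,n]∣m m n)))

-- A list of integers stands for the multiset of its residues mod M, i.e. an element of the
-- group semiring ℕ[ℤ_M]; mult x L is the coefficient of x.
module Multiset (M : ℕ) where

  open ListSum
  open Congruence
  open import Data.Bool using (if_then_else_)
  open import Data.Nat as ℕ using (ℕ; zero; _≤_; z≤n; s≤s)
  import Data.Nat.Properties as ℕ
  import Data.Nat.Divisibility as ℕ
  open import Data.Integer using (ℤ; +_; _+_; _-_; ∣_∣)
  import Data.Integer.Properties as ℤ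
  open import Data.Integer.Tactic.RingSolver using (solve-∀)
  open import Data.Integer.DivMod using (_%ℕ_; n%ℕd<d)
  open import Data.List using (List; []; _∷_; _++_; [_]; map; length; upTo; cartesianProductWith)
  import Data.List.Properties as List
  open import Data.List.Membership.Propositional using (_∈_)
  open import Data.List.Membership.Propositional.Properties using (∈-map⁺; ∈-upTo⁺; ∈-upTo⁻)
  open import Data.List.Relation.Unary.Unique.Propositional.Properties using (upTo⁺)
  open import Data.Product using (_,_)
  open import Algebra.Bundles using (Semiring)
  open import Relation.Binary.PropositionalEquality hiding ([_])
  open import Relation.Nullary using (does; yes; no; contradiction)

  δ₀ : ℤ → ℕ
  δ₀ z = if does (M ℕ.∣? ∣ z ∣) then 1 else 0

  δ : ℤ → ℤ → ℕ
  δ u x = δ₀ (u - x)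

  δ-≡1 : ∀ {u x} → u ≡ x [mod M ] → δ u x ≡ 1
  δ-≡1 {u} {x} (mod M∣u-x) with M ℕ.∣? ∣ u - x ∣
  ... | yes _    = refl
  ... | no  M∤u-x = contradiction M∣u-x M∤u-x

  δ≤1 : ∀ u x → δ u x ≤ 1
  δ≤1 u x with M ℕ.∣? ∣ u - x ∣
  ... | yes _ = s≤s z≤n
  ... | no  _ = z≤n

  δ-positive : ∀ u x → 1 ≤ δ u x → u ≡ x [mod M ]
  δ-positive u x 1≤δ with M ℕ.∣? ∣ u - x ∣
  ... | yes M∣u-x = mod M∣u-x

  δ-congʳ : ∀ u {x x'} → x ≡ x' [mod M ] → δ u x ≡ δ u x'
  δ-congʳ u {x} {x'} x≡x' with M ℕ.∣? ∣ u - x ∣ | M ℕ.∣? ∣ u - x' ∣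
  ... | yes _     | yes _      = refl
  ... | no  _     | no  _      = refl
  ... | yes M∣u-x | no  M∤u-x' = contradiction (∣diff (mod-trans (mod {u} {x} M∣u-x) x≡x')) M∤u-x'
  ... | no  M∤u-x | yes M∣u-x' = contradiction (∣diff (mod-trans (mod {u} {x'} M∣u-x') (mod-sym x≡x'))) M∤u-x

  δ-shift : ∀ u v x → δ (u + v) x ≡ δ v (x - u)
  δ-shift u v x = cong δ₀ (regroup u v x)
    where
    regroup : ∀ u v x → (u + v) - x ≡ v - (x - u)
    regroup = solve-∀

  mult : ℤ → List ℤ → ℕ
  mult x L = ∑ (λ u → δ u x) L

  mult-++ : ∀ x L L' → mult x (L ++ L') ≡ mult x L ℕ.+ mult x L'
  mult-++ x = ∑-++ (λ u → δ u x)

  mult-cong : ∀ {x x'} L → x ≡ x' [mod M ] → mult x L ≡ mult x' L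
  mult-cong L x≡x' = ∑-cong L (λ u → δ-congʳ u x≡x')

  infixl 7 _⊕_
  _⊕_ : List ℤ → List ℤ → List ℤ
  _⊕_ = cartesianProductWith _+_

  ∑-⊕ : ∀ (h : ℤ → ℕ) L L' → ∑ h (L ⊕ L') ≡ ∑ (λ u → ∑ (λ v → h (u + v)) L') L
  ∑-⊕ h []      L' = refl
  ∑-⊕ h (u ∷ L) L' = trans (∑-++ h (map (_+_ u) L') (L ⊕ L'))
                           (cong₂ ℕ._+_ (∑-map h (_+_ u) L') (∑-⊕ h L L'))

  mult-⊕ʳ : ∀ x L L' → mult x (L ⊕ L') ≡ ∑ (λ u → mult (x - u) L') L
  mult-⊕ʳ x L L' = trans (∑-⊕ (λ w → δ w x) L L') (∑-cong L (λ u → ∑-cong L' (λ v → δ-shift u v x)))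

  mult-⊕ˡ : ∀ x L L' → mult x (L ⊕ L') ≡ ∑ (λ v → mult (x - v) L) L'
  mult-⊕ˡ x L L' = begin
    mult x (L ⊕ L')                              ≡⟨ ∑-⊕ (λ w → δ w x) L L' ⟩
    ∑ (λ u → ∑ (λ v → δ (u + v) x) L') L         ≡⟨ ∑-comm (λ u v → δ (u + v) x) L L' ⟩
    ∑ (λ v → ∑ (λ u → δ (u + v) x) L) L'         ≡⟨ ∑-cong L' (λ v → ∑-cong L (λ u → δ-shift' u v)) ⟩
    ∑ (λ v → mult (x - v) L) L'                  ∎
    where
    open ≡-Reasoning
    δ-shift' : ∀ u v → δ (u + v) x ≡ δ u (x - v)
    δ-shift' u v = trans (cong (λ t → δ t x) (ℤ.+-comm u v)) (δ-shift v u x)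

  length-⊕ : ∀ L L' → length (L ⊕ L') ≡ length L ℕ.* length L'
  length-⊕ []      L' = refl
  length-⊕ (u ∷ L) L' = trans (List.length-++ (map (_+_ u) L'))
                              (cong₂ ℕ._+_ (List.length-map (_+_ u) L') (length-⊕ L L'))

  infix 4 _≈_
  _≈_ : List ℤ → List ℤ → Set
  L ≈ L' = ∀ x → mult x L ≡ mult x L'

  ⊕-comm : ∀ L L' → L ⊕ L' ≈ L' ⊕ L
  ⊕-comm L L' x = trans (mult-⊕ʳ x L L') (sym (mult-⊕ˡ x L' L))

  ⊕-cong : ∀ {L₁ L₂ L₃ L₄} → L₁ ≈ L₂ → L₃ ≈ L₄ → L₁ ⊕ L₃ ≈ L₂ ⊕ L₄
  ⊕-cong {L₁} {L₂} {L₃} {L₄} L₁≈L₂ L₃≈L₄ x = begin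
    mult x (L₁ ⊕ L₃)              ≡⟨ mult-⊕ˡ x L₁ L₃ ⟩
    ∑ (λ v → mult (x - v) L₁) L₃  ≡⟨ ∑-cong L₃ (λ v → L₁≈L₂ (x - v)) ⟩
    ∑ (λ v → mult (x - v) L₂) L₃  ≡⟨ mult-⊕ˡ x L₂ L₃ ⟨
    mult x (L₂ ⊕ L₃)              ≡⟨ mult-⊕ʳ x L₂ L₃ ⟩
    ∑ (λ u → mult (x - u) L₃) L₂  ≡⟨ ∑-cong L₂ (λ u → L₃≈L₄ (x - u)) ⟩
    ∑ (λ u → mult (x - u) L₄) L₂  ≡⟨ mult-⊕ʳ x L₂ L₄ ⟨
    mult x (L₂ ⊕ L₄)              ∎
    where open ≡-Reasoning

  ⊕-assoc : ∀ L₁ L₂ L₃ → (L₁ ⊕ L₂) ⊕ L₃ ≈ L₁ ⊕ (L₂ ⊕ L₃)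
  ⊕-assoc L₁ L₂ L₃ x = begin
    mult x ((L₁ ⊕ L₂) ⊕ L₃)                                    ≡⟨ ∑-⊕ (λ w → δ w x) (L₁ ⊕ L₂) L₃ ⟩
    ∑ (λ w → ∑ (λ z → δ (w + z) x) L₃) (L₁ ⊕ L₂)               ≡⟨ ∑-⊕ (λ w → ∑ (λ z → δ (w + z) x) L₃) L₁ L₂ ⟩
    ∑ (λ u → ∑ (λ v → ∑ (λ z → δ ((u + v) + z) x) L₃) L₂) L₁   ≡⟨ ∑-cong L₁ (λ u → ∑-cong L₂ (λ v → ∑-cong L₃
                                                                    (λ z → cong (λ t → δ t x) (ℤ.+-assoc u v z)))) ⟩
    ∑ (λ u → ∑ (λ v → ∑ (λ z → δ (u + (v + z)) x) L₃) L₂) L₁   ≡⟨ ∑-cong L₁ (λ u → ∑-⊕ (λ w → δ (u + w) x) L₂ L₃) ⟨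
    ∑ (λ u → ∑ (λ w → δ (u + w) x) (L₂ ⊕ L₃)) L₁               ≡⟨ ∑-⊕ (λ w → δ w x) L₁ (L₂ ⊕ L₃) ⟨
    mult x (L₁ ⊕ (L₂ ⊕ L₃))                                    ∎
    where open ≡-Reasoning

  𝟙 : List ℤ
  𝟙 = [ + 0 ]

  ⊕-identityˡ : ∀ L → 𝟙 ⊕ L ≈ L
  ⊕-identityˡ L x = trans (∑-⊕ (λ w → δ w x) 𝟙 L)
    (trans (ℕ.+-identityʳ _) (∑-cong L (λ v → cong (λ t → δ t x) (ℤ.+-identityˡ v))))

  ⊕-identityʳ : ∀ L → L ⊕ 𝟙 ≈ L
  ⊕-identityʳ L x = trans (⊕-comm L 𝟙 x) (⊕-identityˡ L x)

  ⊕-distribˡ : ∀ L L₁ L₂ → L ⊕ (L₁ ++ L₂) ≈ L ⊕ L₁ ++ L ⊕ L₂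
  ⊕-distribˡ L L₁ L₂ x = begin
    mult x (L ⊕ (L₁ ++ L₂))                                      ≡⟨ mult-⊕ʳ x L (L₁ ++ L₂) ⟩
    ∑ (λ u → mult (x - u) (L₁ ++ L₂)) L                          ≡⟨ ∑-cong L (λ u → mult-++ (x - u) L₁ L₂) ⟩
    ∑ (λ u → mult (x - u) L₁ ℕ.+ mult (x - u) L₂) L              ≡⟨ ∑-distrib-+ _ _ L ⟩
    ∑ (λ u → mult (x - u) L₁) L ℕ.+ ∑ (λ u → mult (x - u) L₂) L  ≡⟨ cong₂ ℕ._+_ (mult-⊕ʳ x L L₁) (mult-⊕ʳ x L L₂) ⟨
    mult x (L ⊕ L₁) ℕ.+ mult x (L ⊕ L₂)                          ≡⟨ mult-++ x (L ⊕ L₁) (L ⊕ L₂) ⟨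
    mult x (L ⊕ L₁ ++ L ⊕ L₂)                                    ∎
    where open ≡-Reasoning

  ⊕-distribʳ : ∀ L L₁ L₂ → (L₁ ++ L₂) ⊕ L ≈ L₁ ⊕ L ++ L₂ ⊕ L
  ⊕-distribʳ L L₁ L₂ x = cong (mult x) (List.cartesianProductWith-distribʳ-++ _+_ L₁ L₂ L)

  ⊕-zeroʳ : ∀ L → L ⊕ [] ≈ []
  ⊕-zeroʳ L x = cong (mult x) (List.cartesianProductWith-zeroʳ _+_ L)

  ++-cong : ∀ {L₁ L₂ L₃ L₄} → L₁ ≈ L₂ → L₃ ≈ L₄ → L₁ ++ L₃ ≈ L₂ ++ L₄
  ++-cong {L₁} {L₂} {L₃} {L₄} L₁≈L₂ L₃≈L₄ x =
    trans (mult-++ x L₁ L₃) (trans (cong₂ ℕ._+_ (L₁≈L₂ x) (L₃≈L₄ x)) (sym (mult-++ x L₂ L₄)))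

  ++-comm : ∀ L₁ L₂ → L₁ ++ L₂ ≈ L₂ ++ L₁
  ++-comm L₁ L₂ x =
    trans (mult-++ x L₁ L₂) (trans (ℕ.+-comm (mult x L₁) (mult x L₂)) (sym (mult-++ x L₂ L₁)))

  semiring : Semiring _ _
  semiring = record
    { Carrier    = List ℤ
    ; _≈_        = _≈_
    ; _+_        = _++_
    ; _*_        = _⊕_
    ; 0#         = []
    ; 1#         = 𝟙
    ; isSemiring = record
      { isSemiringWithoutAnnihilatingZero = record
        { +-isCommutativeMonoid = record
          { isMonoid = record
            { isSemigroup = record
              { isMagma = record
                { isEquivalence = record
                  { refl  = λ _ → refl
                  ; sym   = λ L≈L' x → sym (L≈L' x)
                  ; trans = λ L≈L' L'≈L'' x → trans (L≈L' x) (L'≈L'' x)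
                  }
                ; ∙-cong = λ {L₁} {L₂} {L₃} {L₄} → ++-cong {L₁} {L₂} {L₃} {L₄}
                }
              ; assoc = λ L₁ L₂ L₃ x → cong (mult x) (List.++-assoc L₁ L₂ L₃)
              }
            ; identity = (λ L x → refl) , (λ L x → cong (mult x) (List.++-identityʳ L))
            }
          ; comm = ++-comm
          }
        ; *-cong     = λ {L₁} {L₂} {L₃} {L₄} → ⊕-cong {L₁} {L₂} {L₃} {L₄}
        ; *-assoc    = ⊕-assoc
        ; *-identity = ⊕-identityˡ , ⊕-identityʳ
        ; distrib    = ⊕-distribˡ , ⊕-distribʳ
        }
      ; zero = (λ L x → refl) , ⊕-zeroʳ
      }
    }

  module _ .{{_ : ℕ.NonZero M}} where

    residues : List ℤ
    residues = map +_ (upTo M)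

    length-residues : length residues ≡ M
    length-residues = trans (List.length-map +_ (upTo M)) (List.length-upTo M)

    %ℕ∈residues : ∀ w → + (w %ℕ M) ∈ residues
    %ℕ∈residues w = ∈-map⁺ +_ (∈-upTo⁺ (n%ℕd<d w M))

    ∑-residues-δ : ∀ w → ∑ (δ w) residues ≡ 1
    ∑-residues-δ w = ℕ.≤-antisym at-most-one at-least-one
      where
      at-least-one : 1 ≤ ∑ (δ w) residues
      at-least-one = ℕ.≤-trans (ℕ.≤-reflexive (sym (δ-≡1 (≡%ℕ M w)))) (∈⇒≤∑ (δ w) residues (%ℕ∈residues w))
      at-most-one : ∑ (δ w) residues ≤ 1
      at-most-one = subst (_≤ 1) (sym (∑-map (δ w) +_ (upTo M)))
        (∑-≤1 (λ k → δ w (+ k)) (upTo M) (upTo⁺ M) (λ k _ → δ≤1 w (+ k))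
          (λ k k' k∈ k'∈ 1≤δ 1≤δ' → residue-unique M (∈-upTo⁻ k∈) (∈-upTo⁻ k'∈)
            (mod-trans (mod-sym (δ-positive w (+ k) 1≤δ)) (δ-positive w (+ k') 1≤δ'))))

    ∑-residues-mult : ∀ L → ∑ (λ x → mult x L) residues ≡ length L
    ∑-residues-mult L = begin
      ∑ (λ x → mult x L) residues        ≡⟨ ∑-comm (λ x w → δ w x) residues L ⟩
      ∑ (λ w → ∑ (δ w) residues) L       ≡⟨ ∑-cong L ∑-residues-δ ⟩
      ∑ (λ w → 1) L                      ≡⟨ ∑-const-1 L ⟩
      length L                           ∎
      where open ≡-Reasoning

-- The prime is passed as suc ℓ-1 so that L ^ ℓ and sums over Fin (suc ℓ) unfold.
module Frobenius (M ℓ-1 : ℕ) (ℓ-prime : Prime (suc ℓ-1)) where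

  open ListSum
  open Congruence
  open Multiset M
  open Primes
  open import Data.Nat as ℕ using (zero; _∸_; z≤n; s≤s)
  import Data.Nat.Properties as ℕ
  import Data.Nat.Divisibility as ℕ
  open import Data.Nat.Combinatorics using (_C_; nCn≡1; nCk≡nC[n∸k])
  open import Data.Integer using (ℤ; +_; _+_; _-_; _*_)
  import Data.Integer.Properties as ℤ
  open import Data.Fin using (Fin; toℕ; fromℕ; inject₁) renaming (zero to fzero; suc to fsuc)
  open import Data.Fin.Properties using (toℕ-inject₁; toℕ-fromℕ; toℕ<n)
  open import Data.Vec.Functional using (foldr)
  open import Data.List using (List; []; _∷_; _++_; [_]; map)
  open import Relation.Binary.PropositionalEquality hiding ([_])
  open import Algebra.Properties.Semiring.Exp semiring using (_^_)
  open import Algebra.Properties.Semiring.Mult semiring using (_×_)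
  import Algebra.Properties.Semiring.Binomial semiring as Binomial

  ℓ : ℕ
  ℓ = suc ℓ-1

  ∑ᶠ : ∀ {n} → (Fin n → ℕ) → ℕ
  ∑ᶠ = foldr ℕ._+_ 0

  mult-∑ᶠ : ∀ z {n} (f : Fin n → List ℤ) → mult z (foldr _++_ [] f) ≡ ∑ᶠ (λ k → mult z (f k))
  mult-∑ᶠ z {zero}  f = refl
  mult-∑ᶠ z {suc n} f = trans (mult-++ z (f fzero) _) (cong (mult z (f fzero) ℕ.+_) (mult-∑ᶠ z (λ k → f (fsuc k))))

  mult-× : ∀ z n L → mult z (n × L) ≡ n ℕ.* mult z L
  mult-× z zero    L = refl
  mult-× z (suc n) L = trans (mult-++ z L (n × L)) (cong (mult z L ℕ.+_) (mult-× z n L))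

  mult-singleton^ : ∀ u n z → mult z ([ u ] ^ n) ≡ δ (+ n * u) z
  mult-singleton^ u zero    z = trans (ℕ.+-identityʳ _) (cong (λ t → δ t z) (sym (ℤ.*-zeroˡ u)))
  mult-singleton^ u (suc n) z = begin
    mult z ([ u ] ⊕ [ u ] ^ n)         ≡⟨ mult-⊕ʳ z [ u ] ([ u ] ^ n) ⟩
    mult (z - u) ([ u ] ^ n) ℕ.+ 0     ≡⟨ ℕ.+-identityʳ _ ⟩
    mult (z - u) ([ u ] ^ n)           ≡⟨ mult-singleton^ u n (z - u) ⟩
    δ (+ n * u) (z - u)                ≡⟨ δ-shift u (+ n * u) z ⟨
    δ (u + + n * u) z                  ≡⟨ cong (λ t → δ t z) (sym (ℤ.suc-* (+ n) u)) ⟩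
    δ (+ suc n * u) z                  ∎
    where open ≡-Reasoning

  ∑ᶠ-≡-last : ∀ n (h : Fin (suc n) → ℕ) → (∀ j → ℓ ℕ.∣ h (inject₁ j)) → + ∑ᶠ h ≡ + h (fromℕ n) [mod ℓ ]
  ∑ᶠ-≡-last zero    h _   = mod-reflexive (cong +_ (ℕ.+-identityʳ (h fzero)))
  ∑ᶠ-≡-last (suc n) h ℓ∣h = +-cong-mod (∣⇒≡0 (ℓ∣h fzero)) (∑ᶠ-≡-last n (λ k → h (fsuc k)) (λ j → ℓ∣h (fsuc j)))

  module BinomialTerms (u : ℤ) (L : List ℤ) (z : ℤ) where

    open Binomial [ u ] L public using (theorem; binomialTerm)

    term : Fin (suc ℓ) → ℕ
    term k = mult z (binomialTerm ℓ k)

    term≡ : ∀ k → term k ≡ (ℓ C toℕ k) ℕ.* mult z ([ u ] ^ toℕ k ⊕ L ^ (ℓ ∸ toℕ k))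
    term≡ k = mult-× z (ℓ C toℕ k) _

    term-first : term fzero ≡ mult z (L ^ ℓ)
    term-first = begin
      term fzero                    ≡⟨ term≡ fzero ⟩
      (ℓ C 0) ℕ.* mult z (𝟙 ⊕ L ^ ℓ) ≡⟨ cong (ℕ._* mult z (𝟙 ⊕ L ^ ℓ)) (trans (nCk≡nC[n∸k] {0} {ℓ} z≤n) (nCn≡1 ℓ)) ⟩
      1 ℕ.* mult z (𝟙 ⊕ L ^ ℓ)       ≡⟨ trans (ℕ.*-identityˡ _) (⊕-identityˡ (L ^ ℓ) z) ⟩
      mult z (L ^ ℓ)                ∎
      where open ≡-Reasoning

    term-middle : ∀ j → ℓ ℕ.∣ term (fsuc (inject₁ j))
    term-middle j = subst (ℓ ℕ.∣_) (sym (term≡ (fsuc (inject₁ j))))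
      (ℕ.∣m⇒∣m*n _ (prime∣binomial ℓ-prime (suc (toℕ (inject₁ j))) (s≤s z≤n)
        (s≤s (subst (ℕ._< ℓ-1) (sym (toℕ-inject₁ j)) (toℕ<n j)))))

    term-last : term (fsuc (fromℕ ℓ-1)) ≡ mult z ([ u ] ^ ℓ)
    term-last = begin
      term (fsuc (fromℕ ℓ-1))                     ≡⟨ term≡ (fsuc (fromℕ ℓ-1)) ⟩
      f (toℕ (fsuc (fromℕ ℓ-1)))                  ≡⟨ cong (λ k → f (suc k)) (toℕ-fromℕ ℓ-1) ⟩
      (ℓ C ℓ) ℕ.* mult z ([ u ] ^ ℓ ⊕ L ^ (ℓ ∸ ℓ)) ≡⟨ cong₂ (λ c e → c ℕ.* mult z ([ u ] ^ ℓ ⊕ L ^ e)) (nCn≡1 ℓ) (ℕ.n∸n≡0 ℓ) ⟩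
      1 ℕ.* mult z ([ u ] ^ ℓ ⊕ 𝟙)                ≡⟨ trans (ℕ.*-identityˡ _) (⊕-identityʳ ([ u ] ^ ℓ) z) ⟩
      mult z ([ u ] ^ ℓ)                          ∎
      where
      open ≡-Reasoning
      f : ℕ → ℕ
      f k = (ℓ C k) ℕ.* mult z ([ u ] ^ k ⊕ L ^ (ℓ ∸ k))

  mult-cons^ℓ : ∀ u L z → + mult z (([ u ] ++ L) ^ ℓ) ≡ + mult z (L ^ ℓ) + + mult z ([ u ] ^ ℓ) [mod ℓ ]
  mult-cons^ℓ u L z = begin
    + mult z (([ u ] ++ L) ^ ℓ)              ≡⟨ cong +_ (trans (theorem (⊕-comm [ u ] L) ℓ z) (mult-∑ᶠ z (binomialTerm ℓ))) ⟩
    + ∑ᶠ term                                ≈⟨ +-cong-mod (mod-refl {x = + term fzero}) (∑ᶠ-≡-last ℓ-1 (λ k → term (fsuc k)) term-middle) ⟩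
    + term fzero + + term (fsuc (fromℕ ℓ-1)) ≡⟨ cong₂ (λ a b → + a + + b) term-first term-last ⟩
    + mult z (L ^ ℓ) + + mult z ([ u ] ^ ℓ)  ∎
    where
    open BinomialTerms u L z
    open ≡-mod-Reasoning ℓ

  frobenius : ∀ L z → + mult z (L ^ ℓ) ≡ + mult z (map (+ ℓ *_) L) [mod ℓ ]
  frobenius []      z = mod-refl
  frobenius (u ∷ L) z = begin
    + mult z (([ u ] ++ L) ^ ℓ)                        ≈⟨ mult-cons^ℓ u L z ⟩
    + mult z (L ^ ℓ) + + mult z ([ u ] ^ ℓ)            ≈⟨ +-cong-mod (frobenius L z) (mod-reflexive (cong +_ (mult-singleton^ u ℓ z))) ⟩
    + mult z (map (+ ℓ *_) L) + + δ (+ ℓ * u) z        ≡⟨ cong +_ (ℕ.+-comm (mult z (map (+ ℓ *_) L)) (δ (+ ℓ * u) z)) ⟩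
    + mult z (map (+ ℓ *_) (u ∷ L))                    ∎
    where open ≡-mod-Reasoning ℓ

module Dilation (M : ℕ) .{{_ : NonZero M}} where

  open ListSum
  open Congruence
  open Multiset M
  open Primes
  open import Data.Nat as ℕ using (zero; suc; _≤_; z≤n; s≤s)
  import Data.Nat.Properties as ℕ
  open import Data.Nat.Divisibility using (_∣_; ∣n⇒∣m*n; 1∣_)
  open import Data.Nat.GCD using (gcd; gcd-greatest; gcd-identityˡ)
  open import Data.Nat.ListAction using (product)
  open import Data.Nat.ListAction.Properties using (∈⇒∣product)
  open import Data.Nat.Primality using (Prime)
  open import Data.Nat.Primality.Factorisation using (PrimeFactorisation; factorise)
  open import Data.Integer using (+_; _*_; _-_)
  open import Data.Integer.DivMod using (_%ℕ_)
  import Data.Integer.Properties as ℤ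
  open import Data.List using ([]; _∷_; map; length)
  import Data.List.Properties as List
  open import Data.List.Membership.Propositional using (_∈_)
  open import Data.List.Relation.Unary.All as All using (All; []; _∷_)
  open import Data.Product using (_×_; _,_)
  open import Relation.Binary.PropositionalEquality
  open import Relation.Nullary using (¬_; contradiction)
  open import Algebra.Properties.Semiring.Exp semiring using (_^_)

  infixr 8 _·_
  _·_ : ℕ → List ℤ → List ℤ
  r · L = map (+ r *_) L

  ·-length : ∀ r L → length (r · L) ≡ length L
  ·-length r = List.length-map (+ r *_)

  1· : ∀ L → 1 · L ≡ L
  1· L = trans (List.map-cong ℤ.*-identityˡ L) (List.map-id L)

  *· : ∀ a b L → (a ℕ.* b) · L ≡ a · b · L
  *· a b L = trans (List.map-cong (λ u → trans (cong (_* u) (ℤ.pos-* a b)) (ℤ.*-assoc (+ a) (+ b) u)) L) (List.map-∘ L)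

  length-^ : ∀ L n → length (L ^ n) ≡ length L ℕ.^ n
  length-^ L zero    = refl
  length-^ L (suc n) = trans (length-⊕ L (L ^ n)) (cong (length L ℕ.*_) (length-^ L n))

  module _ (LA : List ℤ) where

    Tiles : List ℤ → Set
    Tiles L = ∀ x → mult x (LA ⊕ L) ≡ 1

    tiles⇒size : ∀ {L} → Tiles L → length LA ℕ.* length L ≡ M
    tiles⇒size {L} tiles = begin
      length LA ℕ.* length L               ≡⟨ length-⊕ LA L ⟨
      length (LA ⊕ L)                      ≡⟨ ∑-residues-mult (LA ⊕ L) ⟨
      ∑ (λ x → mult x (LA ⊕ L)) residues   ≡⟨ ∑-cong residues tiles ⟩
      ∑ (λ _ → 1) residues                 ≡⟨ ∑-const-1 residues ⟩
      length residues                      ≡⟨ length-residues ⟩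
      M                                    ∎
      where open ≡-Reasoning

    -- M residues share M elements, so covering each one means covering each exactly once.
    covers⇒tiles : ∀ {L} → length LA ℕ.* length L ≡ M → (∀ x → 1 ≤ mult x (LA ⊕ L)) → Tiles L
    covers⇒tiles {L} size covers x = trans (mult-cong (LA ⊕ L) (≡%ℕ M x)) (once (+ (x %ℕ M)) (%ℕ∈residues x))
      where
      total : ∑ (λ y → mult y (LA ⊕ L)) residues ≡ length residues
      total = trans (∑-residues-mult (LA ⊕ L)) (trans (length-⊕ LA L) (trans size (sym length-residues)))
      once = ∑-≡length⇒≡1 (λ y → mult y (LA ⊕ L)) residues (λ y _ → covers y) total

    tiles-prime-dilation : ∀ {ℓ L} → Prime ℓ → ¬ ℓ ∣ M → Tiles L → Tiles (ℓ · L)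
    tiles-prime-dilation {suc ℓ-1} {L} ℓ-prime ℓ∤M tiles = covers⇒tiles size covers
      where
      open Frobenius M ℓ-1 ℓ-prime using (frobenius)
      ℓ = suc ℓ-1
      size : length LA ℕ.* length (ℓ · L) ≡ M
      size = trans (cong (length LA ℕ.*_) (·-length ℓ L)) (tiles⇒size tiles)
      mult-^ℓ : ∀ y → mult y (LA ⊕ L ^ ℓ) ≡ length L ℕ.^ ℓ-1
      mult-^ℓ y = begin
        mult y (LA ⊕ L ^ ℓ)                      ≡⟨ ⊕-assoc LA L (L ^ ℓ-1) y ⟨
        mult y ((LA ⊕ L) ⊕ L ^ ℓ-1)              ≡⟨ mult-⊕ˡ y (LA ⊕ L) (L ^ ℓ-1) ⟩
        ∑ (λ v → mult (y - v) (LA ⊕ L)) (L ^ ℓ-1) ≡⟨ ∑-cong (L ^ ℓ-1) (λ v → tiles (y - v)) ⟩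
        ∑ (λ _ → 1) (L ^ ℓ-1)                    ≡⟨ ∑-const-1 (L ^ ℓ-1) ⟩
        length (L ^ ℓ-1)                         ≡⟨ length-^ L ℓ-1 ⟩
        length L ℕ.^ ℓ-1                         ∎
        where open ≡-Reasoning
      mult-≡ : ∀ y → + mult y (LA ⊕ ℓ · L) ≡ + (length L ℕ.^ ℓ-1) [mod ℓ ]
      mult-≡ y = begin
        + mult y (LA ⊕ ℓ · L)                 ≡⟨ cong +_ (mult-⊕ʳ y LA (ℓ · L)) ⟩
        + ∑ (λ u → mult (y - u) (ℓ · L)) LA   ≈⟨ ∑-cong-mod LA (λ u → mod-sym (frobenius L (y - u))) ⟩
        + ∑ (λ u → mult (y - u) (L ^ ℓ)) LA   ≡⟨ cong +_ (trans (sym (mult-⊕ʳ y LA (L ^ ℓ))) (mult-^ℓ y)) ⟩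
        + (length L ℕ.^ ℓ-1)                  ∎
        where
        open ≡-mod-Reasoning ℓ
        ∑-cong-mod : ∀ {f g : ℤ → ℕ} xs → (∀ x → + f x ≡ + g x [mod ℓ ]) → + ∑ f xs ≡ + ∑ g xs [mod ℓ ]
        ∑-cong-mod []       _   = mod-refl
        ∑-cong-mod (x ∷ xs) f≡g = +-cong-mod (f≡g x) (∑-cong-mod xs f≡g)
      ℓ∤length : ¬ ℓ ∣ length L
      ℓ∤length ℓ∣L = ℓ∤M (subst (ℓ ∣_) (tiles⇒size tiles) (∣n⇒∣m*n (length LA) ℓ∣L))
      covers : ∀ y → 1 ≤ mult y (LA ⊕ ℓ · L)
      covers y with mult y (LA ⊕ ℓ · L) | mult-≡ y
      ... | suc _ | _   = s≤s z≤n
      ... | zero  | 0≡n = contradiction (prime∣^⇒∣ ℓ-prime ℓ-1 (≡0⇒∣ (mod-sym 0≡n))) ℓ∤length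

    module _ {L : List ℤ} (tiles : Tiles L) where

      tiles-∏-dilation : ∀ ps → All (λ p → Prime p × ¬ p ∣ M) ps → Tiles (product ps · L)
      tiles-∏-dilation []       []                     = subst Tiles (sym (1· L)) tiles
      tiles-∏-dilation (p ∷ ps) ((p-prime , p∤M) ∷ ok) =
        subst Tiles (sym (*· p (product ps) L)) (tiles-prime-dilation p-prime p∤M (tiles-∏-dilation ps ok))

      tiles-unit-dilation : ∀ r → gcd r M ≡ 1 → Tiles (r · L)
      tiles-unit-dilation zero coprime x = begin
        mult x (LA ⊕ 0 · L)          ≡⟨ mult-trivial (LA ⊕ 0 · L) ⟩
        length (LA ⊕ 0 · L)          ≡⟨ length-⊕ LA (0 · L) ⟩
        length LA ℕ.* length (0 · L) ≡⟨ cong (length LA ℕ.*_) (·-length 0 L) ⟩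
        length LA ℕ.* length L       ≡⟨ tiles⇒size tiles ⟩
        M                            ≡⟨ M≡1 ⟩
        1                            ∎
        where
        open ≡-Reasoning
        M≡1 : M ≡ 1
        M≡1 = trans (sym (gcd-identityˡ M)) coprime
        mult-trivial : ∀ L' → mult x L' ≡ length L'
        mult-trivial L' = trans (∑-cong L' (λ u → δ-≡1 {u} {x} (mod (subst (_∣ _) (sym M≡1) (1∣ _))))) (∑-const-1 L')
      tiles-unit-dilation r@(suc _) coprime = subst (λ n → Tiles (n · L)) (sym r≡∏) (tiles-∏-dilation ps (All.tabulate ok))
        where
        open PrimeFactorisation (factorise r) renaming (factors to ps; isFactorisation to r≡∏; factorsPrime to ps-prime)
        ok : ∀ {p} → p ∈ ps → Prime p × ¬ p ∣ M
        ok p∈ps = All.lookup ps-prime p∈ps , λ p∣M → prime∤1 (All.lookup ps-prime p∈ps)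
          (subst (_ ∣_) coprime (gcd-greatest (subst (_ ∣_) (sym r≡∏) (∈⇒∣product p∈ps)) p∣M))

module GcdM (M : ℕ) where

  open import Defs using (_∣ℤ_; gcdM)
  open Congruence
  import Data.Nat as ℕ
  open import Data.Nat.Divisibility using (_∣_; ∣-antisym; ∣-trans; ∣n⇒∣m*n; ∣1⇒≡1)
  open import Data.Nat.GCD using (gcd; gcd[m,n]∣m; gcd[m,n]∣n; gcd-greatest; gcd-identityʳ)
  open import Data.Nat.Coprimality using (Coprime; coprime-divisor)
  open import Data.Integer using (ℤ; +_; _*_; _-_; -_; ∣_∣)
  import Data.Integer.Properties as ℤ
  open import Data.Product using (_,_)
  open import Relation.Binary.PropositionalEquality
  open import Data.Integer.Tactic.RingSolver using (solve-∀)

  gcdM∣M : ∀ z → gcdM M z ∣ M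
  gcdM∣M z = gcd[m,n]∣m M ∣ z ∣

  gcdM∣ : ∀ z → gcdM M z ∣ℤ z
  gcdM∣ z = gcd[m,n]∣n M ∣ z ∣

  ∣gcdM : ∀ {d} z → d ∣ M → d ∣ℤ z → d ∣ gcdM M z
  ∣gcdM z = gcd-greatest

  gcdM-cong : ∀ {x y} → x ≡ y [mod M ] → gcdM M x ≡ gcdM M y
  gcdM-cong {x} {y} x≡y = ∣-antisym
    (∣gcdM y (gcdM∣M x) (∣ℤ-resp-mod (gcdM∣M x) x≡y (gcdM∣ x)))
    (∣gcdM x (gcdM∣M y) (∣ℤ-resp-mod (gcdM∣M y) (mod-sym x≡y) (gcdM∣ y)))

  gcdM-neg : ∀ z → gcdM M (- z) ≡ gcdM M z
  gcdM-neg z = cong (gcd M) (ℤ.∣-i∣≡∣i∣ z)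

  gcdM-unit : ∀ r → gcd r M ≡ 1 → ∀ z → gcdM M (+ r * z) ≡ gcdM M z
  gcdM-unit r coprime z = ∣-antisym (∣gcdM z (gcdM∣M (+ r * z)) (coprime-divisor e⊥r (subst (e ∣_) |rz| (gcdM∣ (+ r * z)))))
                                      (∣gcdM (+ r * z) (gcdM∣M z) (subst (gcdM M z ∣_) (sym |rz|) (∣n⇒∣m*n r (gcdM∣ z))))
    where
    e = gcdM M (+ r * z)
    |rz| : ∣ + r * z ∣ ≡ r ℕ.* ∣ z ∣
    |rz| = ℤ.abs-* (+ r) z
    e⊥r : Coprime e r
    e⊥r (i∣e , i∣r) = ∣1⇒≡1 (subst (_ ∣_) coprime (gcd-greatest i∣r (∣-trans i∣e (gcdM∣M (+ r * z)))))

  gcdM≡M⇒∣ : ∀ z → gcdM M z ≡ M → M ∣ℤ z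
  gcdM≡M⇒∣ z gcd≡M = subst (_∣ ∣ z ∣) gcd≡M (gcdM∣ z)

  gcdM-self : ∀ x → gcdM M (x - x) ≡ M
  gcdM-self x = trans (cong (λ z → gcd M ∣ z ∣) (ℤ.+-inverseʳ x)) (gcd-identityʳ M)

  gcdM-sub-comm : ∀ x y → gcdM M (x - y) ≡ gcdM M (y - x)
  gcdM-sub-comm x y = trans (cong (gcdM M) (negate x y)) (gcdM-neg (y - x))
    where
    negate : ∀ x y → x - y ≡ - (y - x)
    negate = solve-∀

  gcdM-dilate : ∀ r → gcd r M ≡ 1 → ∀ {x x' c c'} → + r * x ≡ c [mod M ] → + r * x' ≡ c' [mod M ] →
                gcdM M (c - c') ≡ gcdM M (x - x')
  gcdM-dilate r coprime {x} {x'} {c} {c'} (mod M∣rx-c) (mod M∣rx'-c') =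
    trans (gcdM-cong (mod-sym r[x-x']≡c-c')) (gcdM-unit r coprime (x - x'))
    where
    rearrange : ∀ r x x' c c' → (r * x - c) - (r * x' - c') ≡ r * (x - x') - (c - c')
    rearrange = solve-∀
    r[x-x']≡c-c' : + r * (x - x') ≡ c - c' [mod M ]
    r[x-x']≡c-c' = mod (subst (M ∣ℤ_) (rearrange (+ r) x x' c c') (∣ℤ-- (+ r * x - c) (+ r * x' - c') M∣rx-c M∣rx'-c'))

module Units (M : ℕ) .{{_ : NonZero M}} where

  open import Defs using (_∣ℤ_; gcdM)
  open Congruence
  open GcdM M
  open Primes
  open import Data.Nat as ℕ using (_<_; _/_; ≢-nonZero; ≢-nonZero⁻¹)
  import Data.Nat.Properties as ℕ
  open import Data.Nat.Divisibility as ℕ using (_∣_; _∣?_; ∣m⇒∣m*n; ∣n⇒∣m*n)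
  open import Data.Nat.DivMod using (m/n*n≡m)
  open import Data.Nat.GCD using (gcd; gcd-comm; gcd[m,n]∣m; gcd[m,n]∣n; gcd[m,n]≡0⇒m≡0)
  open import Data.Nat.Coprimality using (Coprime; coprime-Bézout; coprime-/gcd)
  import Data.Nat.GCD as GCD
  open import Data.Nat.ListAction using (product)
  open import Data.Nat.ListAction.Properties using (∈⇒∣product)
  open import Data.Nat.Primality using (Prime; euclidsLemma)
  open import Data.Nat.Primality.Factorisation using (PrimeFactorisation; factorise; factorisationHasAllPrimeFactors)
  open import Data.Integer using (ℤ; +_; _+_; _-_; -_; _*_; ∣_∣)
  import Data.Integer.Divisibility.Signed as Signed
  import Data.Integer.Properties as ℤ
  open import Data.Integer.DivMod using (_%ℕ_; n%ℕd<d)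
  open import Data.Integer.Tactic.RingSolver using (solve-∀)
  open import Data.List using (filter)
  open import Data.List.Membership.Propositional using (_∈_)
  open import Data.List.Membership.Propositional.Properties using (∈-filter⁺; ∈-filter⁻)
  import Data.List.Relation.Unary.All as All
  open import Data.Product using (∃; _×_; _,_; proj₁; proj₂)
  open import Data.Sum using (inj₁; inj₂)
  open import Relation.Binary.PropositionalEquality
  open import Relation.Nullary using (¬_; ¬?; yes; no)

  bézout-in-ℤ : ∀ b c e f → 1 ℕ.+ b ℕ.* c ≡ e ℕ.* f → + 1 + + b * + c ≡ + e * + f
  bézout-in-ℤ b c e f eq = trans (cong (_+_ (+ 1)) (sym (ℤ.pos-* b c))) (trans (cong +_ eq) (ℤ.pos-* e f))

  coprime-quotients : ∀ {m n d} .{{_ : NonZero d}} → gcd m n ≡ d → Coprime (m / d) (n / d)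
  coprime-quotients {m} {n} refl = coprime-/gcd m n

  inverse-mod : ∀ {N a} → Coprime N a → ∃ λ s → s * + a ≡ + 1 [mod N ]
  inverse-mod {N} {a} N⊥a with coprime-Bézout N⊥a
  ... | GCD.Bézout.+- x y 1+ya≡xN = - + y , mod (∣⇒∣ℤ _ (Signed.divides (- + x) (begin
    - + y * + a - + 1          ≡⟨ negate (+ y) (+ a) ⟩
    - (+ 1 + + y * + a)        ≡⟨ cong -_ (bézout-in-ℤ y a x N 1+ya≡xN) ⟩
    - (+ x * + N)              ≡⟨ ℤ.neg-distribˡ-* (+ x) (+ N) ⟩
    - + x * + N                ∎)))
    where
    open ≡-Reasoning
    negate : ∀ u v → - u * v - + 1 ≡ - (+ 1 + u * v)
    negate = solve-∀
  ... | GCD.Bézout.-+ x y 1+xN≡ya = + y , mod (∣⇒∣ℤ _ (Signed.divides (+ x) (begin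
    + y * + a - + 1            ≡⟨ cong (_- + 1) (bézout-in-ℤ x N y a 1+xN≡ya) ⟨
    (+ 1 + + x * + N) - + 1    ≡⟨ cancel (+ 1) (+ x * + N) ⟩
    + x * + N                  ∎)))
    where
    open ≡-Reasoning
    cancel : ∀ u v → (u + v) - u ≡ v
    cancel = solve-∀

  -- Add to r₀ a multiple of N that is divisible by exactly those primes of M not dividing r₀.
  unit-lift : ∀ N r₀ → (∀ {p} → Prime p → p ∣ℤ r₀ → ¬ p ∣ N) → ∃ λ r → (r ≡ r₀ [mod N ]) × gcdM M r ≡ 1
  unit-lift N r₀ r₀⊥N = r , mod N∣r-r₀ , trans (gcd-comm M ∣ r ∣) (coprime-by-primes ∣ r ∣ M no-common)
    where
    open PrimeFactorisation (factorise M) using (factors; isFactorisation; factorsPrime)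
    missing = filter (λ q → ¬? (q ∣? ∣ r₀ ∣)) factors
    t = product missing
    r = r₀ + + (N ℕ.* t)
    r-r₀ : r - r₀ ≡ + (N ℕ.* t)
    r-r₀ = cancel r₀ (+ (N ℕ.* t))
      where
      cancel : ∀ u v → (u + v) - u ≡ v
      cancel = solve-∀
    N∣r-r₀ : N ∣ℤ (r - r₀)
    N∣r-r₀ = subst (N ∣ℤ_) (sym r-r₀) (∣m⇒∣m*n t (ℕ.∣-refl {N}))
    no-common : ∀ {p} → Prime p → p ∣ ∣ r ∣ → ¬ p ∣ M
    no-common {p} p-prime p∣r p∣M with p ∣? ∣ r₀ ∣
    ... | yes p∣r₀ with euclidsLemma N t p-prime (subst (p ∣ℤ_) r-r₀ (∣ℤ-- r r₀ p∣r p∣r₀))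
    ...   | inj₁ p∣N = r₀⊥N p-prime p∣r₀ p∣N
    ...   | inj₂ p∣t with prime∣product⇒∣∈ p-prime missing p∣t
    ...     | q , q∈missing , p∣q with ∈-filter⁻ (λ q → ¬? (q ∣? ∣ r₀ ∣)) {xs = factors} q∈missing
    ...       | q∈factors , q∤r₀ =
      q∤r₀ (subst (_∣ ∣ r₀ ∣) (prime∣prime⇒≡ p-prime (All.lookup factorsPrime q∈factors) p∣q) p∣r₀)
    no-common {p} p-prime p∣r p∣M | no p∤r₀ = p∤r₀ (subst (p ∣ℤ_) (cancel r₀ (+ (N ℕ.* t))) (∣ℤ-- r _ p∣r (∣n⇒∣m*n N p∣t)))
      where
      cancel : ∀ u v → (u + v) - v ≡ u
      cancel = solve-∀
      p∈factors : p ∈ factors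
      p∈factors = factorisationHasAllPrimeFactors p-prime (subst (p ∣_) isFactorisation p∣M) factorsPrime
      p∣t : p ∣ t
      p∣t = ∈⇒∣product (∈-filter⁺ (λ q → ¬? (q ∣? ∣ r₀ ∣)) p∈factors p∤r₀)

  associated-ℕ : ∀ w y → gcd M w ≡ gcd M y → ∃ λ r → gcdM M r ≡ 1 × (r * + w ≡ + y [mod M ])
  associated-ℕ w y gcd≡ = r , proj₂ (proj₂ lift) , rw≡y
    where
    d = gcd M w
    instance
      d≢0 : NonZero d
      d≢0 = ≢-nonZero (λ d≡0 → ≢-nonZero⁻¹ M (gcd[m,n]≡0⇒m≡0 d≡0))
    N = M / d
    w₁ = w / d
    y₁ = y / d
    Nd≡M : N ℕ.* d ≡ M
    Nd≡M = m/n*n≡m (gcd[m,n]∣m M w)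
    w₁d≡w : w₁ ℕ.* d ≡ w
    w₁d≡w = m/n*n≡m (gcd[m,n]∣n M w)
    y₁d≡y : y₁ ℕ.* d ≡ y
    y₁d≡y = m/n*n≡m (subst (_∣ y) (sym gcd≡) (gcd[m,n]∣n M y))
    s = proj₁ (inverse-mod (coprime-/gcd M w))
    sw₁≡1 : s * + w₁ ≡ + 1 [mod N ]
    sw₁≡1 = proj₂ (inverse-mod (coprime-/gcd M w))
    r₀ = s * + y₁
    r₀⊥N : ∀ {p} → Prime p → p ∣ℤ r₀ → ¬ p ∣ N
    r₀⊥N {p} p-prime p∣r₀ p∣N with euclidsLemma ∣ s ∣ y₁ p-prime (subst (p ∣_) (ℤ.abs-* s (+ y₁)) p∣r₀)
    ... | inj₁ p∣s  = prime∤1 p-prime (∣ℤ-resp-mod p∣N sw₁≡1 (subst (p ∣_) (sym (ℤ.abs-* s (+ w₁))) (∣m⇒∣m*n w₁ p∣s)))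
    ... | inj₂ p∣y₁ = prime∤1 p-prime (subst (p ∣_) (coprime-quotients (sym gcd≡) (p∣N , p∣y₁)) ℕ.∣-refl)
    lift = unit-lift N r₀ r₀⊥N
    r = proj₁ lift
    rw₁≡y₁ : r * + w₁ ≡ + y₁ [mod N ]
    rw₁≡y₁ = begin
      r * + w₁            ≈⟨ *-congʳ-mod (+ w₁) (proj₁ (proj₂ lift)) ⟩
      s * + y₁ * + w₁     ≡⟨ swap s (+ y₁) (+ w₁) ⟩
      s * + w₁ * + y₁     ≈⟨ *-congʳ-mod (+ y₁) sw₁≡1 ⟩
      + 1 * + y₁          ≡⟨ ℤ.*-identityˡ (+ y₁) ⟩
      + y₁                ∎
      where
      open ≡-mod-Reasoning N
      swap : ∀ a b c → a * b * c ≡ a * c * b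
      swap = solve-∀
    rw≡y : r * + w ≡ + y [mod M ]
    rw≡y = begin
      r * + w             ≡⟨ cong (r *_) (trans (cong +_ (sym w₁d≡w)) (ℤ.pos-* w₁ d)) ⟩
      r * (+ w₁ * + d)    ≡⟨ ℤ.*-assoc r (+ w₁) (+ d) ⟨
      r * + w₁ * + d      ≈⟨ subst (λ n → r * + w₁ * + d ≡ + y₁ * + d [mod n ]) Nd≡M (*-scale-mod d rw₁≡y₁) ⟩
      + y₁ * + d          ≡⟨ trans (sym (ℤ.pos-* y₁ d)) (cong +_ y₁d≡y) ⟩
      + y                 ∎
      where open ≡-mod-Reasoning M

  associated : ∀ w y → gcdM M w ≡ gcdM M y → ∃ λ r → r < M × gcd r M ≡ 1 × (+ r * w ≡ y [mod M ])
  associated w y gcd≡ = reduce (associated-ℕ (w %ℕ M) (y %ℕ M) gcd-residues)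
    where
    gcd-residues : gcd M (w %ℕ M) ≡ gcd M (y %ℕ M)
    gcd-residues = trans (sym (gcdM-cong (≡%ℕ M w))) (trans gcd≡ (gcdM-cong (≡%ℕ M y)))
    reduce : (∃ λ r → gcdM M r ≡ 1 × (r * + (w %ℕ M) ≡ + (y %ℕ M) [mod M ])) →
             ∃ λ r → r < M × gcd r M ≡ 1 × (+ r * w ≡ y [mod M ])
    reduce (r , r-unit , rw≡y) = r %ℕ M , n%ℕd<d r M , r%M-unit , r%M*w≡y
      where
      r%M-unit : gcd (r %ℕ M) M ≡ 1
      r%M-unit = trans (gcd-comm (r %ℕ M) M) (trans (sym (gcdM-cong (≡%ℕ M r))) r-unit)
      r%M*w≡y : + (r %ℕ M) * w ≡ y [mod M ]
      r%M*w≡y = begin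
        + (r %ℕ M) * w       ≈⟨ *-congʳ-mod w (mod-sym (≡%ℕ M r)) ⟩
        r * w                ≈⟨ *-congˡ-mod r (≡%ℕ M w) ⟩
        r * + (w %ℕ M)       ≈⟨ rw≡y ⟩
        + (y %ℕ M)           ≈⟨ mod-sym (≡%ℕ M y) ⟩
        y                    ∎
        where open ≡-mod-Reasoning M

module Sands (M : ℕ) .{{_ : NonZero M}} (A B : Subset M) (tiling : Tiling ⟦ A ⟧ ⟦ B ⟧) where

  open import Defs using (_∣ℤ_; ι; gcdM)
  open ListSum
  open Congruence
  open Multiset M
  open Dilation M
  open Units M using (associated)
  open import Data.Nat as ℕ using (_≤_; s≤s)
  import Data.Nat.Properties as ℕ
  open import Data.Nat.GCD using (gcd)
  open import Data.Integer using (ℤ; +_; _+_; _-_; _*_)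
  import Data.Integer.Properties as ℤ
  open import Data.Integer.Tactic.RingSolver using (solve-∀)
  open import Data.Fin using (Fin; _≟_)
  open import Data.Fin.Properties using (toℕ-injective)
  open import Data.Fin.Subset using (_∈_)
  open import Data.Fin.Subset.Properties using (_∈?_)
  open import Data.List using (List; filter; allFin; map)
  open import Data.List.Membership.Propositional using () renaming (_∈_ to _∈ₗ_)
  open import Data.List.Membership.Propositional.Properties using (∈-map⁺; ∈-filter⁺; ∈-filter⁻; ∈-allFin)
  open import Data.List.Relation.Unary.Unique.Propositional using (Unique)
  open import Data.List.Relation.Unary.Unique.Propositional.Properties using (allFin⁺; filter⁺)
  open import Data.Product using (_×_; _,_; proj₁; proj₂)
  open import Relation.Binary.PropositionalEquality
  open import Relation.Nullary using (contradiction; yes; no)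
  open import Function using (_∘_)

  elements : Subset M → List (Fin M)
  elements S = filter (_∈? S) (allFin M)

  ∈⇒∈elements : ∀ {S x} → x ∈ S → x ∈ₗ elements S
  ∈⇒∈elements {S} {x} x∈S = ∈-filter⁺ (_∈? S) (∈-allFin x) x∈S

  ∈elements⇒∈ : ∀ {S x} → x ∈ₗ elements S → x ∈ S
  ∈elements⇒∈ {S} x∈ = proj₂ (∈-filter⁻ (_∈? S) {xs = allFin M} x∈)

  toList : Subset M → List ℤ
  toList S = map ι (elements S)

  ι-injective : ∀ {x y : Fin M} → ι x ≡ ι y → x ≡ y
  ι-injective ιx≡ιy = toℕ-injective (ℤ.+-injective ιx≡ιy)

  sum-unique : ∀ {a a' b b'} → a ∈ A → a' ∈ A → b ∈ B → b' ∈ B →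
               ι a + ι b ≡ ι a' + ι b' [mod M ] → a ≡ a' × b ≡ b'
  sum-unique a∈A a'∈A b∈B b'∈B (mod ab≡a'b') = proj₂ tiling _ _ _ _ a∈A a'∈A b∈B b'∈B ab≡a'b'

  tiles : Tiles (toList A) (toList B)
  tiles x = ℕ.≤-antisym at-most-one at-least-one
    where
    inner : Fin M → ℕ.ℕ
    inner a = ∑ (λ b → δ (ι a + ι b) x) (elements B)
    count : mult x (toList A ⊕ toList B) ≡ ∑ inner (elements A)
    count = trans (∑-⊕ (λ w → δ w x) (toList A) (toList B))
                  (trans (∑-map _ ι (elements A)) (∑-cong (elements A) (λ a → ∑-map _ ι (elements B))))
    δ>0⇒ab≡x : ∀ a b → 1 ≤ δ (ι a + ι b) x → ι a + ι b ≡ x [mod M ]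
    δ>0⇒ab≡x a b = δ-positive (ι a + ι b) x
    at-least-one : 1 ≤ mult x (toList A ⊕ toList B)
    at-least-one with proj₁ tiling (residue M x)
    ... | a , b , a∈A , b∈B , ab≡x' = subst (1 ≤_) (sym count)
      (ℕ.≤-trans (ℕ.≤-trans (ℕ.≤-reflexive (sym (δ-≡1 ab≡x))) (∈⇒≤∑ _ (elements B) (∈⇒∈elements b∈B)))
                 (∈⇒≤∑ inner (elements A) (∈⇒∈elements a∈A)))
      where
      ab≡x : ι a + ι b ≡ x [mod M ]
      ab≡x = mod-trans (mod ab≡x') (mod-sym (≡residue M x))
    unique : ∀ {S} → Unique (elements S)
    unique = filter⁺ _ (allFin⁺ M)
    inner≤1 : ∀ a → a ∈ₗ elements A → inner a ≤ 1
    inner≤1 a a∈ = ∑-≤1 _ (elements B) unique (λ b _ → δ≤1 (ι a + ι b) x)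
      (λ b b' b∈ b'∈ δ>0 δ'>0 → proj₂ (sum-unique (∈elements⇒∈ a∈) (∈elements⇒∈ a∈) (∈elements⇒∈ b∈) (∈elements⇒∈ b'∈)
        (mod-trans (δ>0⇒ab≡x a b δ>0) (mod-sym (δ>0⇒ab≡x a b' δ'>0)))))
    at-most-one : mult x (toList A ⊕ toList B) ≤ 1
    at-most-one = subst (_≤ 1) (sym count) (∑-≤1 inner (elements A) unique inner≤1 λ a a' a∈ a'∈ inner>0 inner'>0 →
      let (b  , b∈  , δ>0)  = ∑-positive _ (elements B) inner>0
          (b' , b'∈ , δ'>0) = ∑-positive _ (elements B) inner'>0
      in proj₁ (sum-unique (∈elements⇒∈ a∈) (∈elements⇒∈ a'∈) (∈elements⇒∈ b∈) (∈elements⇒∈ b'∈)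
           (mod-trans (δ>0⇒ab≡x a b δ>0) (mod-sym (δ>0⇒ab≡x a' b' δ'>0)))))

  dilated-sum-injective : ∀ {a a' b b'} r → gcd r M ≡ 1 → a ∈ A → a' ∈ A → b ∈ B → b' ∈ B →
                          ι a + + r * ι b ≡ ι a' + + r * ι b' [mod M ] → a ≡ a'
  dilated-sum-injective {a} {a'} {b} {b'} r coprime a∈A a'∈A b∈B b'∈B x≡x' with a ≟ a'
  ... | yes a≡a' = a≡a'
  ... | no  a≢a' = contradiction (ℕ.≤-trans two-hits (ℕ.≤-reflexive dilated-tiles)) (λ { (s≤s ()) })
    where
    rB = r · toList B
    x = ι a + + r * ι b
    dilated-tiles : mult x (toList A ⊕ rB) ≡ 1
    dilated-tiles = tiles-unit-dilation (toList A) tiles r coprime x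
    hit : ∀ {u} v → v ∈ₗ elements B → + r * ι v ≡ x - u [mod M ] → 1 ≤ mult (x - u) rB
    hit v v∈ rv≡ = ℕ.≤-trans (ℕ.≤-reflexive (sym (δ-≡1 rv≡))) (∈⇒≤∑ _ rB (∈-map⁺ _ (∈-map⁺ ι v∈)))
    hit-a : 1 ≤ mult (x - ι a) rB
    hit-a = hit b (∈⇒∈elements b∈B) (mod-reflexive (cancel (ι a) (+ r * ι b)))
      where
      cancel : ∀ u v → v ≡ (u + v) - u
      cancel = solve-∀
    hit-a' : 1 ≤ mult (x - ι a') rB
    hit-a' = hit b' (∈⇒∈elements b'∈B) (mod-sym (mod-trans (+-cong-mod x≡x' mod-refl)
      (mod-reflexive (cancel (ι a') (+ r * ι b')))))
      where
      cancel : ∀ u v → (u + v) - u ≡ v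
      cancel = solve-∀
    two-hits : 2 ≤ mult x (toList A ⊕ rB)
    two-hits = subst (2 ≤_) (sym (mult-⊕ʳ x (toList A) rB))
      (ℕ.≤-trans (ℕ.+-mono-≤ hit-a hit-a')
        (∈-distinct⇒≤∑ _ (toList A) (∈-map⁺ ι (∈⇒∈elements a∈A)) (∈-map⁺ ι (∈⇒∈elements a'∈A)) (a≢a' ∘ ι-injective)))

  sands : ∀ {a a' b b'} → a ∈ A → a' ∈ A → b ∈ B → b' ∈ B →
          gcdM M (ι a - ι a') ≡ gcdM M (ι b - ι b') → a ≡ a'
  sands {a} {a'} {b} {b'} a∈A a'∈A b∈B b'∈B gcd≡ =
    let r , _ , coprime , r[b-b']≡a-a' = associated (ι b - ι b') (ι a - ι a') (sym gcd≡)
    in sym (dilated-sum-injective r coprime a'∈A a∈A b∈B b'∈B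
              (mod (subst (M ∣ℤ_) (regroup (ι a) (ι a') (ι b) (ι b') (+ r)) (∣diff r[b-b']≡a-a'))))
    where
    regroup : ∀ a a' b b' r → r * (b - b') - (a - a') ≡ (a' + r * b) - (a + r * b')
    regroup = solve-∀

module Valuation {p : ℕ} (p-prime : Prime p) (M' : ℕ) (p∤M' : ¬ p ∣ M') where

  open import Data.Nat using (zero; suc; _*_; _^_; NonZero)
  open import Data.Product using (_,_)
  open import Data.Nat.Properties
  open import Data.Nat.Divisibility
  open import Data.Nat.Primality using (euclidsLemma; prime⇒nonZero; prime⇒irreducible)
  open import Data.Nat.Coprimality using (Coprime; coprime-divisor)
  open import Data.Nat.Tactic.RingSolver using (solve-∀)
  open import Data.Sum using (inj₁; inj₂)
  open import Relation.Binary.PropositionalEquality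
  open import Relation.Nullary using (yes; no; contradiction)

  instance
    p≢0 : NonZero p
    p≢0 = prime⇒nonZero p-prime

  coprime-to-p : ∀ {e} → ¬ p ∣ e → Coprime e p
  coprime-to-p p∤e (i∣e , i∣p) with prime⇒irreducible p-prime i∣p
  ... | inj₁ i≡1 = i≡1
  ... | inj₂ refl = contradiction i∣e p∤e

  ∣p^k*M'-lower : ∀ k e → e ∣ p ^ suc k * M' → ¬ p ^ suc k ∣ e → e ∣ p ^ k * M'
  ∣p^k*M'-lower k e e∣ p^k+1∤e with p ∣? e
  ... | no p∤e = coprime-divisor (coprime-to-p p∤e) (subst (e ∣_) (*-assoc p (p ^ k) M') e∣)
  ∣p^k*M'-lower zero    e e∣ p∤e | yes (divides e₁ refl) =
    contradiction (subst (_∣ e₁ * p) (sym (*-identityʳ p)) (n∣m*n e₁)) p∤e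
  ∣p^k*M'-lower (suc k) e e∣ p^k+2∤e | yes (divides e₁ refl) =
    subst₂ _∣_ (*-comm p e₁) (sym (*-assoc p (p ^ k) M')) (*-monoʳ-∣ p (∣p^k*M'-lower k e₁ e₁∣ p^k+1∤e₁))
    where
    e₁∣ : e₁ ∣ p ^ suc k * M'
    e₁∣ = *-cancelˡ-∣ p (subst₂ _∣_ (*-comm e₁ p) (*-assoc p (p ^ suc k) M') e∣)
    p^k+1∤e₁ : ¬ p ^ suc k ∣ e₁
    p^k+1∤e₁ p^k+1∣e₁ = p^k+2∤e (subst (p ^ suc (suc k) ∣_) (*-comm p e₁) (*-monoʳ-∣ p p^k+1∣e₁))

  ∣p^k*M'-raise : ∀ k e u → e ∣ p ^ k * M' → e ∣ u → p ^ suc k ∣ u → p * e ∣ u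
  ∣p^k*M'-raise k e u e∣ e∣u p^k+1∣u with p ∣? e
  ∣p^k*M'-raise k e u e∣ (divides t refl) p^k+1∣u | no p∤e
    with euclidsLemma t e p-prime (m*n∣⇒m∣ p (p ^ k) p^k+1∣u)
  ... | inj₁ (divides t₁ refl) = subst (p * e ∣_) (sym (*-assoc t₁ p e)) (n∣m*n t₁)
  ... | inj₂ p∣e               = contradiction p∣e p∤e
  ∣p^k*M'-raise zero    e u e∣ e∣u _ | yes p∣e =
    contradiction (∣-trans p∣e (subst (e ∣_) (*-identityˡ M') e∣)) p∤M'
  ∣p^k*M'-raise (suc k) e u e∣ e∣u p^k+2∣u | yes (divides e₁ refl) with m*n∣⇒m∣ p (p ^ suc k) p^k+2∣u
  ... | divides u₁ refl = subst₂ _∣_ (cong (p *_) (*-comm p e₁)) (*-comm p u₁)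
                            (*-monoʳ-∣ p (∣p^k*M'-raise k e₁ u₁ e₁∣ e₁∣u₁ p^k+1∣u₁))
    where
    e₁∣ : e₁ ∣ p ^ k * M'
    e₁∣ = *-cancelˡ-∣ p (subst₂ _∣_ (*-comm e₁ p) (*-assoc p (p ^ k) M') e∣)
    e₁∣u₁ : e₁ ∣ u₁
    e₁∣u₁ = *-cancelˡ-∣ p (subst₂ _∣_ (*-comm e₁ p) (*-comm u₁ p) e∣u)
    p^k+1∣u₁ : p ^ suc k ∣ u₁
    p^k+1∣u₁ = *-cancelˡ-∣ p (subst (p * p ^ suc k ∣_) (*-comm u₁ p) p^k+2∣u)

  ∣p^k*M'-lcm : ∀ k x → p ^ k * M' ∣ x → p ^ suc k ∣ x → p ^ suc k * M' ∣ x
  ∣p^k*M'-lcm k x (divides s refl) p^k+1∣x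
    with euclidsLemma M' s p-prime (*-cancelˡ-∣ (p ^ k) {{m^n≢0 p k}} (subst₂ _∣_ (*-comm p (p ^ k)) (rearrange s (p ^ k) M') p^k+1∣x))
    where
    rearrange : ∀ s a b → s * (a * b) ≡ a * (b * s)
    rearrange = solve-∀
  ... | inj₁ p∣M' = contradiction p∣M' p∤M'
  ... | inj₂ (divides s₁ refl) = divides s₁ (rearrange s₁ p (p ^ k) M')
    where
    rearrange : ∀ s p a b → s * p * (a * b) ≡ s * (p * a * b)
    rearrange = solve-∀

module FiberGcd {p : ℕ} (p-prime : Prime p) (n' M' : ℕ) (p∤M' : ¬ p ∣ M') {M : ℕ} (M≡ : M ≡ p ℕ.^ suc n' ℕ.* M') where

  open import Defs using (_∣ℤ_; gcdM)
  open Congruence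
  open GcdM M
  open Valuation p-prime M' p∤M'
  open import Data.Nat.Properties using (*-assoc; *-comm; m^n≢0)
  open import Data.Nat.Divisibility
  open import Data.Integer using (ℤ; _-_; ∣_∣)
  open import Relation.Binary.PropositionalEquality
  open import Relation.Nullary using (yes; no)
  open import Data.Nat using (_*_; _^_)

  pⁿ : ℕ
  pⁿ = p ^ suc n'

  M/p : ℕ
  M/p = p ^ n' * M'

  M≡p*M/p : M ≡ p * M/p
  M≡p*M/p = trans M≡ (*-assoc p (p ^ n') M')

  pⁿ∣M : pⁿ ∣ M
  pⁿ∣M = subst (pⁿ ∣_) (sym M≡) (m∣m*n M')

  M/p∣M : M/p ∣ M
  M/p∣M = subst (M/p ∣_) (sym M≡p*M/p) (n∣m*n p)

  pⁿ∤M/p : ¬ pⁿ ∣ M/p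
  pⁿ∤M/p pⁿ∣ = p∤M' (*-cancelˡ-∣ (p ^ n') {{m^n≢0 p n'}} (subst (_∣ M/p) (*-comm p (p ^ n')) pⁿ∣))

  data GcdComparison (u w : ℤ) : Set where
    gcd-≡  : gcdM M u ≡ gcdM M w → GcdComparison u w
    gcd-pˡ : pⁿ ∣ℤ u → ¬ pⁿ ∣ℤ w → gcdM M u ≡ p * gcdM M w → GcdComparison u w
    gcd-pʳ : ¬ pⁿ ∣ℤ u → pⁿ ∣ℤ w → gcdM M w ≡ p * gcdM M u → GcdComparison u w

  private
    M/p∣-sym : ∀ u w → M/p ∣ℤ (u - w) → M/p ∣ℤ (w - u)
    M/p∣-sym u w M/p∣ = ∣diff (mod-sym (mod {u} {w} M/p∣))

    gcdM∣M/p : ∀ u → ¬ pⁿ ∣ℤ u → gcdM M u ∣ M/p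
    gcdM∣M/p u pⁿ∤u = ∣p^k*M'-lower n' (gcdM M u) (subst (gcdM M u ∣_) M≡ (gcdM∣M u)) (λ pⁿ∣g → pⁿ∤u (∣-trans pⁿ∣g (gcdM∣ u)))

    gcdM-∣ : ∀ u w → M/p ∣ℤ (u - w) → ¬ pⁿ ∣ℤ u → gcdM M u ∣ gcdM M w
    gcdM-∣ u w M/p∣ pⁿ∤u = ∣gcdM w (gcdM∣M u) (∣ℤ-resp-mod (gcdM∣M/p u pⁿ∤u) (mod {u} {w} M/p∣) (gcdM∣ u))

    gcdM-p* : ∀ u w → M/p ∣ℤ (u - w) → pⁿ ∣ℤ u → ¬ pⁿ ∣ℤ w → gcdM M u ≡ p * gcdM M w
    gcdM-p* u w M/p∣ pⁿ∣u pⁿ∤w = ∣-antisym gu∣pe pe∣gu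
      where
      e = gcdM M w
      e∣M/p : e ∣ M/p
      e∣M/p = gcdM∣M/p w pⁿ∤w
      pe∣gu : p * e ∣ gcdM M u
      pe∣gu = ∣gcdM u (subst (p * e ∣_) (sym M≡p*M/p) (*-monoʳ-∣ p e∣M/p))
        (∣p^k*M'-raise n' e _ e∣M/p (∣ℤ-resp-mod e∣M/p (mod-sym (mod {u} {w} M/p∣)) (gcdM∣ w)) pⁿ∣u)
      gu∣pe : gcdM M u ∣ p * e
      gu∣pe with ∣-trans (m*n∣⇒m∣ p (p ^ n') (∣gcdM u pⁿ∣M pⁿ∣u)) ∣-refl
      ... | divides f gu≡fp = subst (_∣ p * e) (trans (*-comm p f) (sym gu≡fp)) (*-monoʳ-∣ p f∣e)
        where
        f∣M/p : f ∣ M/p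
        f∣M/p = *-cancelˡ-∣ p (subst₂ _∣_ (trans gu≡fp (*-comm f p)) M≡p*M/p (gcdM∣M u))
        f∣u : f ∣ℤ u
        f∣u = ∣-trans (subst (f ∣_) (sym gu≡fp) (m∣m*n p)) (gcdM∣ u)
        f∣e : f ∣ e
        f∣e = ∣gcdM w (∣-trans f∣M/p M/p∣M) (∣ℤ-resp-mod f∣M/p (mod {u} {w} M/p∣) f∣u)

  compare-gcd : ∀ u w → M/p ∣ℤ (u - w) → GcdComparison u w
  compare-gcd u w M/p∣ with pⁿ ∣? ∣ u ∣ | pⁿ ∣? ∣ w ∣
  ... | yes pⁿ∣u | yes pⁿ∣w = gcd-≡ (gcdM-cong (mod {u} {w} M∣u-w))
    where
    M∣u-w : M ∣ℤ (u - w)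
    M∣u-w = subst (_∣ _) (sym M≡) (∣p^k*M'-lcm n' _ M/p∣ (∣ℤ-- u w pⁿ∣u pⁿ∣w))
  ... | no pⁿ∤u  | no pⁿ∤w  = gcd-≡ (∣-antisym (gcdM-∣ u w M/p∣ pⁿ∤u) (gcdM-∣ w u (M/p∣-sym u w M/p∣) pⁿ∤w))
  ... | yes pⁿ∣u | no pⁿ∤w  = gcd-pˡ pⁿ∣u pⁿ∤w (gcdM-p* u w M/p∣ pⁿ∣u pⁿ∤w)
  ... | no pⁿ∤u  | yes pⁿ∣w = gcd-pʳ pⁿ∤u pⁿ∣w (gcdM-p* w u (M/p∣-sym u w M/p∣) pⁿ∣w pⁿ∤u)

module Equivalences (M : ℕ) .{{_ : NonZero M}} {p : ℕ} (p-prime : Prime p) (n' M' : ℕ) (p∤M' : ¬ p ∣ M')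
  (M≡ : M ≡ p ℕ.^ suc n' ℕ.* M') (A B : Subset M) (tiling : Tiling ⟦ A ⟧ ⟦ B ⟧) where

  open import Defs
  open Congruence
  open GcdM M
  open FiberGcd p-prime n' M' p∤M' M≡
  open Sands M A B tiling using (sands)
  open Units M using (associated)
  open import Data.Nat using (_<_; z<s)
  import Data.Nat.Properties as ℕ
  open import Data.Nat.Divisibility using (divides; ∣-trans; ∣-refl; m∣m*n; n∣m*n; m*n∣⇒m∣; *-monoʳ-∣; *-cancelˡ-∣)
  open import Data.Nat.DivMod using (_/_; m*n/n≡m)
  open import Data.Nat.GCD using (gcd)
  open import Data.Nat.Primality using (prime⇒nonZero; prime⇒nonTrivial)
  open import Data.Integer using (ℤ; +_; _+_; _-_; -_; _*_)
  import Data.Integer.Properties as ℤ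
  open import Data.Integer.Tactic.RingSolver using (solve-∀)
  open import Data.Fin using (Fin; toℕ; fromℕ<)
  open import Data.Fin.Properties using (toℕ-fromℕ<)
  open import Data.Fin.Subset using (_∈_)
  open import Data.Empty using (⊥)
  open import Data.Product using (_×_; _,_; ∃; proj₁; proj₂)
  open import Function.Bundles using (_⇔_; mk⇔)
  open import Relation.Binary.PropositionalEquality
  open import Relation.Nullary using (contradiction)
  open import Data.Nat using (_^_)

  I = (m : ℕ) → pⁿ ∣ m → m ∣ M → Div ⟦ A ⟧ m → ¬ Div ⟦ B ⟧ (m /ₚ p-prime)
  II = (r : Fin M) → InR r → UniformSplitCA p-prime (suc n') ⟦ A ⟧ (scale r ⟦ B ⟧)
  III = (a b x : Fin M) → a ∈ A → b ∈ B → Fiber p-prime a x →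
        (a' : Fin M) → Sat ⟦ A ⟧ ⟦ B ⟧ x b a' → Π x pⁿ a'

  instance
    p≢0 : NonZero p
    p≢0 = prime⇒nonZero p-prime

  /ₚ-p* : ∀ {m k} → m ≡ p ℕ.* k → m /ₚ p-prime ≡ k
  /ₚ-p* {m} {k} m≡pk = trans (cong (_/ p) (trans m≡pk (ℕ.*-comm p k))) (m*n/n≡m k p)

  M/ₚp≡M/p : M /ₚ p-prime ≡ M/p
  M/ₚp≡M/p = /ₚ-p* M≡p*M/p

  pⁿ∤m/p : ∀ {m} → pⁿ ∣ m → m ∣ M → ¬ pⁿ ∣ m /ₚ p-prime
  pⁿ∤m/p {m} pⁿ∣m m∣M pⁿ∣m/p with m*n∣⇒m∣ p (p ^ n') pⁿ∣m
  ... | divides k m≡kp = p∤M' (*-cancelˡ-∣ pⁿ {{ℕ.m^n≢0 p (suc n')}} pⁿ*p∣pⁿ*M')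
    where
    m≡pk : m ≡ p ℕ.* k
    m≡pk = trans m≡kp (ℕ.*-comm k p)
    p*pⁿ∣m : p ℕ.* pⁿ ∣ m
    p*pⁿ∣m = subst (p ℕ.* pⁿ ∣_) (sym m≡pk) (*-monoʳ-∣ p (subst (pⁿ ∣_) (/ₚ-p* m≡pk) pⁿ∣m/p))
    pⁿ*p∣pⁿ*M' : pⁿ ℕ.* p ∣ pⁿ ℕ.* M'
    pⁿ*p∣pⁿ*M' = subst₂ _∣_ (ℕ.*-comm p pⁿ) M≡ (∣-trans p*pⁿ∣m m∣M)

  fiber-≡ : ∀ {z w} → Fiber p-prime z w → ι z ≡ ι w [mod M/p ]
  fiber-≡ {z} {w} (t , _ , M∣) = mod-sym (begin
    ι w                           ≈⟨ mod-∣ M/p∣M (mod {ι w} {ι z + + (t ℕ.* (M /ₚ p-prime))} M∣) ⟩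
    ι z + + (t ℕ.* (M /ₚ p-prime)) ≈⟨ +-cong-mod (mod-refl {x = ι z}) (∣⇒≡0 (subst (λ k → M/p ∣ t ℕ.* k) (sym M/ₚp≡M/p) (n∣m*n t))) ⟩
    ι z + + 0                     ≡⟨ ℤ.+-identityʳ (ι z) ⟩
    ι z                           ∎)
    where open ≡-mod-Reasoning M/p

  fiber-self : ∀ (z : Fin M) → Fiber p-prime z z
  fiber-self z = 0 , ℕ.<-trans (z<s {0}) (ℕ.nonTrivial⇒n>1 p {{prime⇒nonTrivial p-prime}}) ,
    ∣diff (mod-reflexive {x = ι z} (sym (ℤ.+-identityʳ (ι z))))

  next : Fin M → Fin M
  next z = residue M (ι z + + (1 ℕ.* (M /ₚ p-prime)))

  fiber-next : ∀ z → Fiber p-prime z (next z)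
  fiber-next z = 1 , ℕ.nonTrivial⇒n>1 p {{prime⇒nonTrivial p-prime}} , ∣diff (mod-sym (≡residue M (ι z + + (1 ℕ.* (M /ₚ p-prime)))))

  next-≡ : ∀ z → ι (next z) ≡ ι z + + M/p [mod M ]
  next-≡ z = mod-trans (mod-sym (≡residue M (ι z + + (1 ℕ.* (M /ₚ p-prime)))))
                       (mod-reflexive (cong (λ k → ι z + + k) (trans (ℕ.*-identityˡ _) M/ₚp≡M/p)))

  I-violated : I → ∀ {a a' b b'} → a ∈ A → a' ∈ A → b ∈ B → b' ∈ B →
               pⁿ ∣ℤ (ι a - ι a') → gcdM M (ι a - ι a') ≡ p ℕ.* gcdM M (ι b - ι b') → ⊥
  I-violated hI {a} {a'} {b} {b'} a∈A a'∈A b∈B b'∈B pⁿ∣u gu≡p*gv =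
    hI (gcdM M (ι a - ι a')) (∣gcdM (ι a - ι a') pⁿ∣M pⁿ∣u) (gcdM∣M (ι a - ι a'))
       (a , a' , a∈A , a'∈A , refl) (b , b' , b∈B , b'∈B , sym (/ₚ-p* gu≡p*gv))

  equal-gcd⇒equal : ∀ {a a' b b'} → a ∈ A → a' ∈ A → b ∈ B → b' ∈ B →
                    gcdM M (ι a - ι a') ≡ gcdM M (ι b - ι b') → gcdM M (ι a - ι a') ≡ M
  equal-gcd⇒equal {a} a∈A a'∈A b∈B b'∈B g≡ =
    subst (λ a' → gcdM M (ι a - ι a') ≡ M) (sands a∈A a'∈A b∈B b'∈B g≡) (gcdM-self (ι a))

  I⇒III : I → III
  I⇒III hI a b x a∈A b∈B x∈aF a' (a'∈A , b' , b'∈B , gw≡gb) =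
    conclude (compare-gcd u w (∣diff (+-cong-mod (fiber-≡ x∈aF) (mod-refl {x = - ι a'}))))
    where
    u = ι a - ι a'
    w = ι x - ι a'
    conclude : GcdComparison u w → pⁿ ∣ℤ w
    conclude (gcd-≡ gu≡gw) =
      ∣-trans pⁿ∣M (gcdM≡M⇒∣ w (trans (sym gu≡gw) (equal-gcd⇒equal a∈A a'∈A b∈B b'∈B (trans gu≡gw gw≡gb))))
    conclude (gcd-pˡ pⁿ∣u _ gu≡p*gw) = contradiction (trans gu≡p*gw (cong (p ℕ.*_) gw≡gb)) (I-violated hI a∈A a'∈A b∈B b'∈B pⁿ∣u)
    conclude (gcd-pʳ _ pⁿ∣w _)      = pⁿ∣w

  III⇒I : III → I
  III⇒I hIII m pⁿ∣m m∣M (a , a' , a∈A , a'∈A , gu≡m) (b , b' , b∈B , b'∈B , gb≡m/p) =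
    conclude (compare-gcd u w (∣diff (+-cong-mod (fiber-≡ (fiber-next a)) (mod-refl {x = - ι a'}))))
    where
    x = next a
    u = ι a - ι a'
    w = ι x - ι a'
    pⁿ∣u : pⁿ ∣ℤ u
    pⁿ∣u = ∣-trans pⁿ∣m (subst (_∣ _) gu≡m (gcdM∣ u))
    w≡u+M/p : w ≡ u + + M/p [mod M ]
    w≡u+M/p = begin
      ι x - ι a'            ≈⟨ +-cong-mod (next-≡ a) (mod-refl {x = - ι a'}) ⟩
      (ι a + + M/p) - ι a'  ≡⟨ swap (ι a) (+ M/p) (ι a') ⟩
      u + + M/p             ∎
      where
      open ≡-mod-Reasoning M
      swap : ∀ a d a' → (a + d) - a' ≡ (a - a') + d
      swap = solve-∀
    conclude : GcdComparison u w → ⊥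
    conclude (gcd-≡ gu≡gw) = pⁿ∤M/p (subst (pⁿ ∣ℤ_) (cancel u (+ M/p)) (∣ℤ-- (u + + M/p) u pⁿ∣u+M/p pⁿ∣u))
      where
      pⁿ∣w : pⁿ ∣ℤ w
      pⁿ∣w = ∣-trans (subst (pⁿ ∣_) gu≡gw (∣gcdM u pⁿ∣M pⁿ∣u)) (gcdM∣ w)
      pⁿ∣u+M/p : pⁿ ∣ℤ (u + + M/p)
      pⁿ∣u+M/p = ∣ℤ-resp-mod pⁿ∣M w≡u+M/p pⁿ∣w
      cancel : ∀ u d → (u + d) - u ≡ d
      cancel = solve-∀
    conclude (gcd-pˡ _ pⁿ∤w gu≡p*gw) = pⁿ∤w (hIII a b x a∈A b∈B (fiber-next a) a' a'∈Sat)
      where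
      a'∈Sat : Sat ⟦ A ⟧ ⟦ B ⟧ x b a'
      a'∈Sat = a'∈A , b' , b'∈B , trans (sym (/ₚ-p* (trans (sym gu≡m) gu≡p*gw))) (sym gb≡m/p)
    conclude (gcd-pʳ pⁿ∤u _ _) = pⁿ∤u pⁿ∣u

  in-fiber : ∀ {x w} z → x ≡ ι w [mod M ] → Fiber p-prime z w → x ≡ ι z [mod M/p ]
  in-fiber {w = w} z x≡w w∈zF = mod-trans (mod-∣ M/p∣M x≡w) (mod-sym (fiber-≡ {z} {w} w∈zF))

  split-pair : I → ∀ (r : Fin M) → InR r → ∀ {a a' b b' c c' : Fin M} → a ∈ A → a' ∈ A → b ∈ B → b' ∈ B →
               ι r * ι b ≡ ι c [mod M ] → ι r * ι b' ≡ ι c' [mod M ] → ι a + ι c ≡ ι a' + ι c' [mod M/p ] →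
               pⁿ ∣ℤ (ι c - ι c') × (a ≢ a' → (p ^ n') ∣ℤ (ι a - ι a') × ¬ pⁿ ∣ℤ (ι a - ι a'))
  split-pair hI r r-unit {a} {a'} {b} {b'} {c} {c'} a∈A a'∈A b∈B b'∈B (mod M∣rb-c) (mod M∣rb'-c') (mod M/p∣) =
    conclude (compare-gcd u v (subst (M/p ∣ℤ_) (regroup (ι a) (ι a') (ι c) (ι c')) M/p∣))
    where
    u = ι a - ι a'
    v = ι c' - ι c
    regroup : ∀ a a' c c' → (a + c) - (a' + c') ≡ (a - a') - (c' - c)
    regroup = solve-∀
    gv≡gb : gcdM M v ≡ gcdM M (ι b' - ι b)
    gv≡gb = gcdM-dilate (toℕ r) r-unit (mod {ι r * ι b'} M∣rb'-c') (mod {ι r * ι b} M∣rb-c)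
    pⁿ∣c-c' : pⁿ ∣ℤ v → pⁿ ∣ℤ (ι c - ι c')
    pⁿ∣c-c' pⁿ∣v = ∣diff (mod-sym (mod {ι c'} {ι c} pⁿ∣v))
    conclude : GcdComparison u v → pⁿ ∣ℤ (ι c - ι c') × (a ≢ a' → (p ^ n') ∣ℤ u × ¬ pⁿ ∣ℤ u)
    conclude (gcd-≡ gu≡gv) = pⁿ∣c-c' (∣-trans pⁿ∣M (gcdM≡M⇒∣ v (trans (sym gu≡gv) gu≡M))) , λ a≢a' → contradiction a≡a' a≢a'
      where
      a≡a' = sands a∈A a'∈A b'∈B b∈B (trans gu≡gv gv≡gb)
      gu≡M = equal-gcd⇒equal a∈A a'∈A b'∈B b∈B (trans gu≡gv gv≡gb)
    conclude (gcd-pˡ pⁿ∣u _ gu≡p*gv) = contradiction (trans gu≡p*gv (cong (p ℕ.*_) gv≡gb)) (I-violated hI a∈A a'∈A b'∈B b∈B pⁿ∣u)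
    conclude (gcd-pʳ pⁿ∤u pⁿ∣v _) = pⁿ∣c-c' pⁿ∣v , λ _ → p^n'∣u , pⁿ∤u
      where
      p^n'∣u : (p ^ n') ∣ℤ u
      p^n'∣u = ∣ℤ-resp-mod (m∣m*n M') (mod-sym (mod {u} {v} (subst (M/p ∣ℤ_) (regroup (ι a) (ι a') (ι c) (ι c')) M/p∣)))
                 (∣-trans (n∣m*n p) pⁿ∣v)

  I⇒II : I → II
  I⇒II hI r r-unit z = C-parity , A-parity
    where
    C = scale r ⟦ B ⟧
    Z = Fiber p-prime z
    comm : ∀ x y w → M ∣ℤ ((x + y) - w) → y + x ≡ w [mod M ]
    comm x y w M∣ = mod-trans (mod-reflexive (ℤ.+-comm y x)) (mod {x + y} {w} M∣)
    C-parity : ∀ c c' → ΣC ⟦ A ⟧ C Z c → ΣC ⟦ A ⟧ C Z c' → pⁿ ∣ℤ (ι c - ι c')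
    C-parity c c' ((b , b∈B , rb≡c) , a , a∈A , w , w∈Z , c+a≡w) ((b' , b'∈B , rb'≡c') , a' , a'∈A , w' , w'∈Z , c'+a'≡w') =
      proj₁ (split-pair hI r r-unit a∈A a'∈A b∈B b'∈B (mod {ι r * ι b} rb≡c) (mod {ι r * ι b'} rb'≡c')
        (mod-trans (in-fiber z (comm (ι c) (ι a) (ι w) c+a≡w) w∈Z)
                   (mod-sym (in-fiber z (comm (ι c') (ι a') (ι w') c'+a'≡w') w'∈Z))))
    A-parity : ∀ a a' → ΣA ⟦ A ⟧ C Z a → ΣA ⟦ A ⟧ C Z a' → a ≢ a' →
               ((p ^ n') ∣ℤ (ι a - ι a')) × ¬ (pⁿ ∣ℤ (ι a - ι a'))
    A-parity a a' (a∈A , c , (b , b∈B , rb≡c) , w , w∈Z , a+c≡w) (a'∈A , c' , (b' , b'∈B , rb'≡c') , w' , w'∈Z , a'+c'≡w') =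
      proj₂ (split-pair hI r r-unit a∈A a'∈A b∈B b'∈B (mod {ι r * ι b} rb≡c) (mod {ι r * ι b'} rb'≡c')
        (mod-trans (in-fiber z (mod {ι a + ι c} {ι w} a+c≡w) w∈Z)
                   (mod-sym (in-fiber z (mod {ι a' + ι c'} {ι w'} a'+c'≡w') w'∈Z))))

  -- By (II), a + rb' and a' + rb lie in one fiber of A ⊕ rB, so the splitting parity puts pⁿ into (b - b', M).
  II⇒pⁿ∣gcd : II → ∀ {a a' b b'} → a ∈ A → a' ∈ A → b ∈ B → b' ∈ B → ∀ (R : Fin M) → InR R →
              ι R * (ι b - ι b') ≡ (ι a - ι a') + + M/p [mod M ] → pⁿ ∣ gcdM M (ι b - ι b')
  II⇒pⁿ∣gcd hII {a} {a'} {b} {b'} a∈A a'∈A b∈B b'∈B R R-unit R[b-b']≡y =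
    subst (pⁿ ∣_) gcd-c-c' (∣gcdM (ι c - ι c') pⁿ∣M (proj₁ (hII R R-unit z) c c' c∈ΣC c'∈ΣC))
    where
    c  = residue M (ι R * ι b')
    c' = residue M (ι R * ι b)
    z  = residue M (ι a + ι c)
    c'+a'≡next-z : ι c' + ι a' ≡ ι (next z) [mod M ]
    c'+a'≡next-z = begin
      ι c' + ι a'                                ≈⟨ +-cong-mod (mod-sym (≡residue M (ι R * ι b))) (mod-refl {x = ι a'}) ⟩
      ι R * ι b + ι a'                           ≡⟨ expand (ι R) (ι b) (ι b') (ι a') ⟩
      (ι R * ι b' + ι R * (ι b - ι b')) + ι a'   ≈⟨ +-cong-mod (+-cong-mod (mod-refl {x = ι R * ι b'}) R[b-b']≡y) (mod-refl {x = ι a'}) ⟩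
      (ι R * ι b' + ((ι a - ι a') + + M/p)) + ι a' ≡⟨ regroup (ι R * ι b') (ι a) (ι a') (+ M/p) ⟩
      (ι a + ι R * ι b') + + M/p                 ≈⟨ +-cong-mod (+-cong-mod (mod-refl {x = ι a}) (≡residue M (ι R * ι b'))) (mod-refl {x = + M/p}) ⟩
      (ι a + ι c) + + M/p                        ≈⟨ +-cong-mod (≡residue M (ι a + ι c)) (mod-refl {x = + M/p}) ⟩
      ι z + + M/p                                ≈⟨ mod-sym (next-≡ z) ⟩
      ι (next z)                                 ∎
      where
      open ≡-mod-Reasoning M
      expand : ∀ r b b' a' → r * b + a' ≡ (r * b' + r * (b - b')) + a'
      expand = solve-∀
      regroup : ∀ rb' a a' d → (rb' + ((a - a') + d)) + a' ≡ (a + rb') + d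
      regroup = solve-∀
    c∈ΣC : ΣC ⟦ A ⟧ (scale R ⟦ B ⟧) (Fiber p-prime z) c
    c∈ΣC = (b' , b'∈B , ∣diff (≡residue M (ι R * ι b'))) , a , a∈A , z , fiber-self z ,
           ∣diff (mod-trans (mod-reflexive (ℤ.+-comm (ι c) (ι a))) (≡residue M (ι a + ι c)))
    c'∈ΣC : ΣC ⟦ A ⟧ (scale R ⟦ B ⟧) (Fiber p-prime z) c'
    c'∈ΣC = (b , b∈B , ∣diff (≡residue M (ι R * ι b))) , a' , a'∈A , next z , fiber-next z , ∣diff c'+a'≡next-z
    gcd-c-c' : gcdM M (ι c - ι c') ≡ gcdM M (ι b - ι b')
    gcd-c-c' = trans (gcdM-dilate (toℕ R) R-unit (≡residue M (ι R * ι b')) (≡residue M (ι R * ι b)))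
                     (gcdM-sub-comm (ι b') (ι b))

  II⇒I : II → I
  II⇒I hII m pⁿ∣m m∣M (a , a' , a∈A , a'∈A , gu≡m) (b , b' , b∈B , b'∈B , gb≡m/p) =
    pⁿ∤m/p pⁿ∣m m∣M (subst (pⁿ ∣_) gb≡m/p (realise (associated (ι b - ι b') y gb≡gy)))
    where
    u = ι a - ι a'
    y = u + + M/p
    pⁿ∣u : pⁿ ∣ℤ u
    pⁿ∣u = ∣-trans pⁿ∣m (subst (_∣ _) gu≡m (gcdM∣ u))
    gcd-y : GcdComparison u y → gcdM M y ≡ m /ₚ p-prime
    gcd-y (gcd-≡ gu≡gy) = contradiction (subst (pⁿ ∣ℤ_) (cancel u (+ M/p)) (∣ℤ-- y u pⁿ∣y pⁿ∣u)) pⁿ∤M/p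
      where
      pⁿ∣y : pⁿ ∣ℤ y
      pⁿ∣y = ∣-trans (subst (pⁿ ∣_) gu≡gy (∣gcdM u pⁿ∣M pⁿ∣u)) (gcdM∣ y)
      cancel : ∀ u d → (u + d) - u ≡ d
      cancel = solve-∀
    gcd-y (gcd-pˡ _ _ gu≡p*gy) = sym (/ₚ-p* (trans (sym gu≡m) gu≡p*gy))
    gcd-y (gcd-pʳ pⁿ∤u _ _)    = contradiction pⁿ∣u pⁿ∤u
    u-y : M/p ∣ℤ (u - y)
    u-y = subst (M/p ∣ℤ_) (shift u (+ M/p)) (∣ℤ-neg (+ M/p) (∣-refl {M/p}))
      where
      shift : ∀ u d → - d ≡ u - (u + d)
      shift = solve-∀
    gb≡gy : gcdM M (ι b - ι b') ≡ gcdM M y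
    gb≡gy = trans gb≡m/p (sym (gcd-y (compare-gcd u y u-y)))
    realise : (∃ λ r → r < M × gcd r M ≡ 1 × (+ r * (ι b - ι b') ≡ y [mod M ])) → pⁿ ∣ gcdM M (ι b - ι b')
    realise (r , r<M , r-unit , r[b-b']≡y) = II⇒pⁿ∣gcd hII a∈A a'∈A b∈B b'∈B (fromℕ< r<M)
      (subst (λ k → gcd k M ≡ 1) (sym (toℕ-fromℕ< r<M)) r-unit)
      (subst (λ k → + k * (ι b - ι b') ≡ y [mod M ]) (sym (toℕ-fromℕ< r<M)) r[b-b']≡y)

  equivalences : (I ⇔ II) × (I ⇔ III)
  equivalences = mk⇔ I⇒II II⇒I , mk⇔ I⇒III III⇒I

open Primes using (prime∤1; prime∣^⇒∣; prime∣prime⇒≡)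
open import Defs
open import Data.Nat using (zero; _≤_; _^_)
import Data.Nat.Properties as ℕ
open import Algebra.Properties.CommutativeSemigroup ℕ.*-commutativeSemigroup using (x∙yz≈y∙xz)
open import Data.Nat.Primality using (euclidsLemma; prime⇒nonZero)
open import Data.Fin using (Fin) renaming (zero to fzero; suc to fsuc)
import Data.Fin.Properties as Fin
open import Data.Fin.Subset using (_∈_)
open import Data.Product using (∃; _×_; _,_)
open import Data.Sum using (inj₁; inj₂)
open import Function.Bundles using (_⇔_)
open import Function.Definitions using (Injective)
open import Relation.Binary.PropositionalEquality using (_≢_; refl; trans; cong)

prime∤∏ : ∀ {q} → Prime q → ∀ K (f : Fin K → ℕ) → (∀ k → ¬ q ∣ f k) → ¬ q ∣ ∏ K f
prime∤∏ q-prime zero    f q∤f q∣1 = prime∤1 q-prime q∣1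
prime∤∏ q-prime (suc K) f q∤f q∣∏ with euclidsLemma (f fzero) (∏ K (λ k → f (fsuc k))) q-prime q∣∏
... | inj₁ q∣f₀ = q∤f fzero q∣f₀
... | inj₂ q∣∏' = prime∤∏ q-prime K (λ k → f (fsuc k)) (λ k → q∤f (fsuc k)) q∣∏'

modulus-nonZero : ∀ K (p n : Fin K → ℕ) → (∀ k → Prime (p k)) → NonZero (modulus K p n)
modulus-nonZero zero    p n pr = _
modulus-nonZero (suc K) p n pr =
  ℕ.m*n≢0 (p fzero ^ n fzero) (modulus K (λ k → p (fsuc k)) (λ k → n (fsuc k)))
    {{ℕ.m^n≢0 (p fzero) (n fzero) {{prime⇒nonZero (pr fzero)}}}}
    {{modulus-nonZero K (λ k → p (fsuc k)) (λ k → n (fsuc k)) (λ k → pr (fsuc k))}}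

prime∤other-power : ∀ {K} {p : Fin K → ℕ} → (∀ k → Prime (p k)) → Injective _≡_ _≡_ p →
                    ∀ {j k} e → j ≢ k → ¬ p j ∣ p k ^ e
prime∤other-power pr p-injective {j} {k} e j≢k p∣ =
  j≢k (p-injective (prime∣prime⇒≡ (pr j) (pr k) (prime∣^⇒∣ (pr j) e p∣)))

modulus-split : ∀ K (p n : Fin K → ℕ) → (∀ k → Prime (p k)) → Injective _≡_ _≡_ p → ∀ i →
                ∃ λ M' → modulus K p n ≡ p i ^ n i ℕ.* M' × ¬ p i ∣ M'
modulus-split (suc K) p n pr p-injective fzero =
  modulus K (λ k → p (fsuc k)) (λ k → n (fsuc k)) , refl ,
  prime∤∏ (pr fzero) K (λ k → p (fsuc k) ^ n (fsuc k)) (λ k → prime∤other-power pr p-injective (n (fsuc k)) λ ())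
modulus-split (suc K) p n pr p-injective (fsuc j)
  with modulus-split K (λ k → p (fsuc k)) (λ k → n (fsuc k)) (λ k → pr (fsuc k)) (λ eq → Fin.suc-injective (p-injective eq)) j
... | M'' , M≡ , p∤M'' = q₀ ℕ.* M'' , trans (cong (q₀ ℕ.*_) M≡) (x∙yz≈y∙xz q₀ (p (fsuc j) ^ n (fsuc j)) M'') , p∤q₀M''
  where
  q₀ = p fzero ^ n fzero
  p∤q₀M'' : ¬ p (fsuc j) ∣ q₀ ℕ.* M''
  p∤q₀M'' p∣ with euclidsLemma q₀ M'' (pr (fsuc j)) p∣
  ... | inj₁ p∣q₀  = prime∤other-power pr p-injective (n fzero) (λ ()) p∣q₀
  ... | inj₂ p∣M'' = p∤M'' p∣M''

lemma5p6 : (K : ℕ) (p n : Fin K → ℕ) (pr : (k : Fin K) → Prime (p k)) →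
    Injective _≡_ _≡_ p → ((k : Fin K) → 1 ≤ n k) →
    (A B : Subset (modulus K p n)) → Tiling ⟦ A ⟧ ⟦ B ⟧ →
    (i : Fin K) → Φpp (p i) (n i) ∣ₚ mask A →
    let M = modulus K p n
        I = (m : ℕ) → (p i ^ n i) ∣ m → m ∣ M → Div ⟦ A ⟧ m → ¬ Div ⟦ B ⟧ (m /ₚ pr i)
        II = (r : Fin M) → InR r → UniformSplitCA (pr i) (n i) ⟦ A ⟧ (scale r ⟦ B ⟧)
        III = (a b x : Fin M) → a ∈ A → b ∈ B → Fiber (pr i) a x →
              (a' : Fin M) → Sat ⟦ A ⟧ ⟦ B ⟧ x b a' → Π x (p i ^ n i) a'
    in (I ⇔ II) × (I ⇔ III)
lemma5p6 K p n pr p-injective 1≤n A B tiling i _ with modulus-split K p n pr p-injective i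
... | M' , M≡ , p∤M' with n i | 1≤n i
...   | suc n' | _ = Equivalences.equivalences (modulus K p n) {{modulus-nonZero K p n pr}} (pr i) n' M' p∤M' M≡ A B tiling
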